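{- Let $G$ be a graph with $n$ vertices and $m$ edges, let $\mathbf{c}=(c_1,\ldots,c_s)$ be a composition of $n$, and write $e_k=E_k(c_1,\ldots,c_s)$. Under a uniformly random $\mathbf{c}$-coloring of $G$, let $M_i(G)$ be the number of edges with both endpoints of color $i$, $M(G)=\sum_i M_i(G)$, and $L(G)=m-M(G)$ (so $L(G)$ and $M(G)$ have the same variance). Then for $i=1,\ldots,s$ the mean $\overline{M}_i$ and variance $\sigma_i^2$ of $M_i(G)$ are $$\overline{M}_i=m\frac{c_i^{\underline{2}}}{n^{\underline{2}}},$$ $$\sigma_i^2=\frac{c_i^{\underline{3}}(n-c_i)}{n^{\underline{4}}}\Sigma_2(G)-\Big(\Big[\frac{c_i^{\underline{2}}}{n^{\underline{2}}}\Big]^2-\frac{c_i^{\underline{4}}}{n^{\underline{4}}}\Big)m^2+\Big(\frac{c_i^{\underline{2}}}{n^{\underline{2}}}-2\frac{c_i^{\underline{3}}}{n^{\underline{3}}}+\frac{c_i^{\underline{4}}}{n^{\underline{4}}}\Big)m .$$ The means of $L(G)$ and $M(G)$ are $$\mathbb{E}[L(G)]=\frac{2me_2}{n^{\underline{2}}},\qquad \mathbb{E}[M(G)]=\frac{m}{n^{\underline{2}}}\sum_{i=1}^s c_i^{\underline{2}},$$ and their common variance is $$\sigma^2=(a(\mathbf{c})-b(\mathbf{c}))\Sigma_2(G)+m^2\Big(b(\mathbf{c})-4\Big[\frac{e_2}{n^{\underline{2}}}\Big]^2\Big)+m\Big(\frac{2e_2}{n^{\underline{2}}}-2a(\mathbf{c})+b(\mathbf{c})\Big),$$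 where $$a(\mathbf{c})=\frac{e_2}{n^{\underline{2}}}+\frac{3e_3}{n^{\underline{3}}},\qquad b(\mathbf{c})=\frac{4}{n^{\underline{4}}}\big(e_2^2-(n-1)e_2-3e_3\big).$$
   Context: A composition $\mathbf{c}=(c_1,\ldots,c_s)$ of $n$ is a tuple of positive integers summing to $n$. A $\mathbf{c}$-coloring of $G$ is a map $f:V(G)\to[s]$ with $|f^{ -1}(\{i\})|=c_i$; a uniformly random one is chosen with the uniform measure on all such maps. $x^{\underline{b}}=x(x-1)\cdots(x-b+1)$ is the falling factorial ($x^{\underline0}=1$, and $x^{\underline b}=0$ if $0\le x<b$). $E_k$ is the elementary symmetric polynomial of degree $k$ in $s$ variables ($E_k=0$ for $k>s$). $\Sigma_2(G)=\sum_{v\in V(G)}d_G(v)^2$. -}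

module Defs where

open import Data.Nat as ℕ using (ℕ; zero; suc; _∸_; _<_)
open import Data.Bool using (Bool; true; false)
open import Data.Fin as Fin using (Fin)
open import Data.Fin.Properties using (all?)
open import Data.List as List using (List; []; _∷_; length; filter; map; concatMap; allFin)
open import Data.Product using (_×_; _,_; proj₁; proj₂)
open import Data.Vec.Functional as VF using (Vector)
open import Data.Rational as ℚ using (ℚ; 0ℚ; _÷_; _*_; _-_; _+_)
open import Relation.Binary.PropositionalEquality using (_≡_)
open import Relation.Nullary using (yes; no)
open import Relation.Nullary.Decidable using (⌊_⌋)
open import Data.Bool using (T)
open import Data.Integer as ℤ using (ℤ)
import Data.Nat.ListAction

ff : ℕ → ℕ → ℕ
ff x zero    = 1
ff x (suc b) = ff x b ℕ.* (x ∸ b)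

esym : ℕ → List ℕ → ℕ
esym zero    _        = 1
esym (suc k) []       = 0
esym (suc k) (x ∷ xs) = x ℕ.* esym k xs ℕ.+ esym (suc k) xs

sumFin : ∀ {s} → (Fin s → ℕ) → ℕ
sumFin {s} f = Data.Nat.ListAction.sum (map f (allFin s))

sumFinℚ : ∀ {s} → (Fin s → ℚ) → ℚ
sumFinℚ {s} f = List.foldr _+_ 0ℚ (map f (allFin s))

record Composition (n s : ℕ) : Set where
  field
    part     : Fin s → ℕ
    positive : ∀ i → 0 < part i
    sums     : sumFin part ≡ n

record SimpleGraph (n : ℕ) : Set where
  field
    adj    : Fin n → Fin n → Bool
    sym    : ∀ u v → adj u v ≡ adj v u
    irrefl : ∀ v → adj v v ≡ false

module _ {n : ℕ} (G : SimpleGraph n) where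
  open SimpleGraph G

  allPairs : List (Fin n × Fin n)
  allPairs = concatMap (λ u → map (λ v → (u , v)) (allFin n)) (allFin n)

  edges : List (Fin n × Fin n)
  edges = filter (λ e → T? (adj (proj₁ e) (proj₂ e)) ×-dec (proj₁ e Fin.<? proj₂ e)) allPairs
    where
      open import Relation.Nullary.Decidable using (_×-dec_)
      open import Data.Bool.Properties using (T?)

  numEdges : ℕ
  numEdges = length edges

  degree : Fin n → ℕ
  degree v = length (filter (λ u → Data.Bool.Properties.T? (adj v u)) (allFin n))
    where import Data.Bool.Properties

  Σ₂ : ℕ
  Σ₂ = sumFin (λ v → degree v ℕ.* degree v)

allMaps : (n s : ℕ) → List (Fin n → Fin s)
allMaps zero    s = (λ ()) ∷ []
allMaps (suc n) s = concatMap (λ f → map (λ i → i VF.∷ f) (allFin s)) (allMaps n s)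

fiberSize : ∀ {n s} → (Fin n → Fin s) → Fin s → ℕ
fiberSize {n} f i = length (filter (λ v → f v Fin.≟ i) (allFin n))

colorings : ∀ {n s} → Composition n s → List (Fin n → Fin s)
colorings {n} {s} c =
  filter (λ f → all? (λ i → fiberSize f i ℕ.≟ Composition.part c i)) (allMaps n s)

-- division with the convention p / 0 = 0 (only used with nonzero denominators)
_÷₀_ : ℚ → ℚ → ℚ
p ÷₀ q with q ℚ.≟ 0ℚ
... | yes _  = 0ℚ
... | no q≢0 = _÷_ p q {{ℚ.≢-nonZero q≢0}}

infixl 7 _÷₀_

⟦_⟧ : ℕ → ℚ
⟦ k ⟧ = (ℤ.+ k) ℚ./ 1

module _ {n s : ℕ} (c : Composition n s) where
  mean : ((Fin n → Fin s) → ℚ) → ℚ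
  mean X = List.foldr _+_ 0ℚ (map X (colorings c)) ÷₀ ⟦ length (colorings c) ⟧

  variance : ((Fin n → Fin s) → ℚ) → ℚ
  variance X = mean (λ f → (X f - mean X) * (X f - mean X))

module _ {n s : ℕ} (G : SimpleGraph n) where
  Mᵢ : Fin s → (Fin n → Fin s) → ℕ
  Mᵢ i f = length (filter (λ e → (f (proj₁ e) Fin.≟ i) Relation.Nullary.Decidable.×-dec (f (proj₂ e) Fin.≟ i)) (edges G))
    where import Relation.Nullary.Decidable

  M : (Fin n → Fin s) → ℕ
  M f = sumFin (λ i → Mᵢ i f)

  L : (Fin n → Fin s) → ℕ
  L f = numEdges G ∸ M f

-- Write Mᵢ as a sum over edges of the indicator that both endpoints get color i. The first two
-- moments of Mᵢ, and of M = Σᵢ Mᵢ, then become sums over edges and ordered pairs of edges of the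
-- number of colorings giving prescribed colors to prescribed vertices. For distinct vertices this
-- number is computed one vertex at a time: prescribing one more vertex v ↦ a multiplies it by
-- (cₐ − #vertices already sent to a) / (n − #vertices already prescribed), a consequence of the
-- double counting identity (r + 1) · #(r, e) = (eₐ + 1) · #(r + 1, e + δₐ) for the numbers #(r, e)
-- of maps Fin r → Fin s with fiber sizes e. For two edges the result depends only on the number of
-- shared endpoints, and the ordered pairs of edges sharing 2, 1, 0 endpoints number m, Σ₂ − 2m and
-- m² − Σ₂ + m. Summing over colors and expressing Σᵢ cᵢ↓k through e₂ and e₃ gives the formulas for
-- M, and L = m − M has the same variance.

module Submission where

open import Defs
open import Data.Nat as ℕ using (ℕ; zero; suc; _≤_; _<_; _∸_; z≤n; s≤s; _≤?_)
import Data.Nat.Properties as ℕₚ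
open import Data.Fin as Fin using (Fin; zero; suc)
open import Data.Product using (_×_; _,_; Σ; proj₁; proj₂)
open import Data.Vec.Functional using (toList)
open import Data.List as List using (List; []; _∷_; map; filter; concatMap; allFin; _++_; length; tabulate)
open import Level using (Level)
open import Relation.Binary.PropositionalEquality

private
  variable
    ℓ ℓ′ : Level
    A : Set ℓ
    B : Set ℓ′

-- ℕ arithmetic is opened only inside this module: from its end on, _+_ and _*_ are those of ℚ.
module Counting where

  open import Data.Nat using (_+_; _*_)
  open import Data.Nat.Tactic.RingSolver using (solve-∀)
  import Data.Nat.ListAction as ListAction
  open import Data.Bool using (T)
  open import Data.Bool.Properties using (T?)
  open import Data.Fin.Properties using (all?; ¬∀⟶∃¬)
  import Data.Fin.Properties as Finₚ
  open import Data.List.Properties using (length-map)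
  open import Data.List.Relation.Unary.All using (All; []; _∷_)
  open import Data.List.Relation.Unary.AllPairs using ([]; _∷_)
  open import Data.List.Relation.Unary.Unique.Propositional using (Unique)
  open import Data.Maybe using (Maybe; just; nothing)
  open import Data.Sum using (inj₁; inj₂)
  open import Data.Vec.Functional as Vector using (updateAt)
  open import Data.Vec.Functional.Properties using (updateAt-minimal)
  open import Data.Empty using (⊥-elim)
  open import Function using (_⇔_; Equivalence; mk⇔)
  open import Relation.Binary.Definitions using (tri<; tri≈; tri>)
  open import Relation.Nullary using (Dec; yes; no; ¬_)
  open import Relation.Nullary.Decidable using (_×-dec_)
  open import Algebra.Properties.Semiring.Sum ℕₚ.+-*-semiring public
    using (sum; sum-syntax; sum-cong-≗; ∑-distrib-+; ∑-comm; *-distribˡ-sum; *-distribʳ-sum; sum-replicate-zero)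

  𝟙 : ∀ {p} {P : Set p} → Dec P → ℕ
  𝟙 (yes _) = 1
  𝟙 (no _)  = 0

  𝟙-yes : ∀ {p} {P : Set p} (d : Dec P) → P → 𝟙 d ≡ 1
  𝟙-yes (yes _) _  = refl
  𝟙-yes (no ¬p) p = ⊥-elim (¬p p)

  𝟙-no : ∀ {p} {P : Set p} (d : Dec P) → ¬ P → 𝟙 d ≡ 0
  𝟙-no (yes p) ¬p = ⊥-elim (¬p p)
  𝟙-no (no _)  _  = refl

  𝟙-cong : ∀ {p q} {P : Set p} {Q : Set q} → P ⇔ Q → (d : Dec P) (e : Dec Q) → 𝟙 d ≡ 𝟙 e
  𝟙-cong P⇔Q (yes p) e = sym (𝟙-yes e (Equivalence.to P⇔Q p))
  𝟙-cong P⇔Q (no ¬p) e = sym (𝟙-no e (λ q → ¬p (Equivalence.from P⇔Q q)))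

  𝟙-× : ∀ {p q} {P : Set p} {Q : Set q} (d : Dec P) (e : Dec Q) → 𝟙 (d ×-dec e) ≡ 𝟙 d * 𝟙 e
  𝟙-× (yes _) (yes _) = refl
  𝟙-× (yes _) (no _)  = refl
  𝟙-× (no _)  _       = refl

  𝟙-idem : ∀ {p} {P : Set p} (d : Dec P) → 𝟙 d * 𝟙 d ≡ 𝟙 d
  𝟙-idem (yes _) = refl
  𝟙-idem (no _)  = refl

  𝟙≤1 : ∀ {p} {P : Set p} (d : Dec P) → 𝟙 d ≤ 1
  𝟙≤1 (yes _) = s≤s z≤n
  𝟙≤1 (no _)  = z≤n

  δ : ∀ {n} → Fin n → Fin n → ℕ
  δ i j = 𝟙 (i Fin.≟ j)

  δ-refl : ∀ {n} (i : Fin n) → δ i i ≡ 1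
  δ-refl i = 𝟙-yes (i Fin.≟ i) refl

  ∑-δ : ∀ {n} (j : Fin n) (h : Fin n → ℕ) → ∑[ i < n ] (δ i j * h i) ≡ h j
  ∑-δ {suc n} zero h = begin
    1 * h zero + ∑[ i < n ] (𝟙 (suc i Fin.≟ zero) * h (suc i))
      ≡⟨ cong₂ _+_ (ℕₚ.*-identityˡ (h zero)) (sum-cong-≗ (λ i → cong (_* h (suc i)) (𝟙-no (suc i Fin.≟ zero) λ ()))) ⟩
    h zero + ∑[ i < n ] 0
      ≡⟨ cong (h zero +_) (sum-replicate-zero n) ⟩
    h zero + 0
      ≡⟨ ℕₚ.+-identityʳ (h zero) ⟩
    h zero ∎
    where open ≡-Reasoning
  ∑-δ {suc n} (suc j) h =
    cong₂ _+_ (cong (_* h zero) (𝟙-no (zero Fin.≟ suc j) λ ()))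
              (trans (sum-cong-≗ λ i → cong (_* h (suc i)) (𝟙-cong (mk⇔ Finₚ.suc-injective (cong suc)) (suc i Fin.≟ suc j) (i Fin.≟ j)))
                     (∑-δ j (λ i → h (suc i))))

  ∑-δ′ : ∀ {n} (j : Fin n) (h : Fin n → ℕ) → ∑[ i < n ] (δ j i * h i) ≡ h j
  ∑-δ′ j h = trans (sum-cong-≗ λ i → cong (_* h i) (𝟙-cong (mk⇔ sym sym) (j Fin.≟ i) (i Fin.≟ j))) (∑-δ j h)

  ∑-const : ∀ n (c : ℕ) → ∑[ i < n ] c ≡ n * c
  ∑-const zero    c = refl
  ∑-const (suc n) c = cong (c +_) (∑-const n c)

  ∑-∑-*ˡ : ∀ {m n} (c : ℕ) (h : Fin m → Fin n → ℕ) → ∑[ i < m ] ∑[ j < n ] (c * h i j) ≡ c * ∑[ i < m ] ∑[ j < n ] h i j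
  ∑-∑-*ˡ c h = trans (sum-cong-≗ λ i → sym (*-distribˡ-sum c (h i))) (sym (*-distribˡ-sum c (λ i → sum (h i))))

  ∑-∑-distrib-+ : ∀ {m n} (g h : Fin m → Fin n → ℕ) →
    ∑[ i < m ] ∑[ j < n ] (g i j + h i j) ≡ ∑[ i < m ] ∑[ j < n ] g i j + ∑[ i < m ] ∑[ j < n ] h i j
  ∑-∑-distrib-+ g h = trans (sum-cong-≗ λ i → ∑-distrib-+ (g i) (h i)) (∑-distrib-+ (λ i → sum (g i)) (λ i → sum (h i)))

  ∑-∑-cong : ∀ {m n} {g h : Fin m → Fin n → ℕ} → (∀ i j → g i j ≡ h i j) →
    ∑[ i < m ] ∑[ j < n ] g i j ≡ ∑[ i < m ] ∑[ j < n ] h i j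
  ∑-∑-cong g≗h = sum-cong-≗ λ i → sum-cong-≗ (g≗h i)

  sum-*-sum : ∀ {m n} (f : Fin m → ℕ) (g : Fin n → ℕ) → sum f * sum g ≡ ∑[ i < m ] ∑[ j < n ] (f i * g j)
  sum-*-sum f g = trans (*-distribʳ-sum (sum g) f) (sum-cong-≗ λ i → *-distribˡ-sum (f i) g)

  sumOver : List A → (A → ℕ) → ℕ
  sumOver []       h = 0
  sumOver (x ∷ xs) h = h x + sumOver xs h

  infixl 10 sumOver
  syntax sumOver xs (λ x → e) = ∑[ x ∈ xs ] e

  ∑ₗ-cong : (xs : List A) {g h : A → ℕ} → (∀ x → g x ≡ h x) → ∑[ x ∈ xs ] g x ≡ ∑[ x ∈ xs ] h x
  ∑ₗ-cong []       g≗h = refl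
  ∑ₗ-cong (x ∷ xs) g≗h = cong₂ _+_ (g≗h x) (∑ₗ-cong xs g≗h)

  ∑ₗ-distrib-+ : (xs : List A) (g h : A → ℕ) → ∑[ x ∈ xs ] (g x + h x) ≡ ∑[ x ∈ xs ] g x + ∑[ x ∈ xs ] h x
  ∑ₗ-distrib-+ []       g h = refl
  ∑ₗ-distrib-+ (x ∷ xs) g h = trans (cong (g x + h x +_) (∑ₗ-distrib-+ xs g h)) (swap (g x) (h x) _ _)
    where
      swap : ∀ a b c d → (a + b) + (c + d) ≡ (a + c) + (b + d)
      swap = solve-∀

  ∑ₗ-*ˡ : (xs : List A) (c : ℕ) (h : A → ℕ) → ∑[ x ∈ xs ] (c * h x) ≡ c * ∑[ x ∈ xs ] h x
  ∑ₗ-*ˡ []       c h = sym (ℕₚ.*-zeroʳ c)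
  ∑ₗ-*ˡ (x ∷ xs) c h = trans (cong (c * h x +_) (∑ₗ-*ˡ xs c h)) (sym (ℕₚ.*-distribˡ-+ c (h x) _))

  ∑ₗ-const : (xs : List A) (c : ℕ) → ∑[ x ∈ xs ] c ≡ length xs * c
  ∑ₗ-const []       c = refl
  ∑ₗ-const (x ∷ xs) c = cong (c +_) (∑ₗ-const xs c)

  ∑ₗ-∑-comm : ∀ {n} (xs : List A) (h : A → Fin n → ℕ) → ∑[ x ∈ xs ] ∑[ i < n ] h x i ≡ ∑[ i < n ] ∑[ x ∈ xs ] h x i
  ∑ₗ-∑-comm {n = n} []       h = sym (sum-replicate-zero n)
  ∑ₗ-∑-comm     (x ∷ xs) h = trans (cong (sum (h x) +_) (∑ₗ-∑-comm xs h)) (sym (∑-distrib-+ (h x) _))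

  ∑ₗ-filter : ∀ {p} {P : A → Set p} (P? : ∀ x → Dec (P x)) (xs : List A) (h : A → ℕ) →
              ∑[ x ∈ filter P? xs ] h x ≡ ∑[ x ∈ xs ] (𝟙 (P? x) * h x)
  ∑ₗ-filter P? []       h = refl
  ∑ₗ-filter P? (x ∷ xs) h with P? x
  ... | yes _ = cong₂ _+_ (sym (ℕₚ.*-identityˡ (h x))) (∑ₗ-filter P? xs h)
  ... | no _  = ∑ₗ-filter P? xs h

  length≡∑ₗ : (xs : List A) → length xs ≡ ∑[ x ∈ xs ] 1
  length≡∑ₗ xs = sym (trans (∑ₗ-const xs 1) (ℕₚ.*-identityʳ _))

  length-filter≡∑ₗ : ∀ {p} {P : A → Set p} (P? : ∀ x → Dec (P x)) (xs : List A) →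
                     length (filter P? xs) ≡ ∑[ x ∈ xs ] 𝟙 (P? x)
  length-filter≡∑ₗ P? xs =
    trans (length≡∑ₗ (filter P? xs)) (trans (∑ₗ-filter P? xs (λ _ → 1)) (∑ₗ-cong xs λ x → ℕₚ.*-identityʳ _))

  ∑ₗ-++ : (xs ys : List A) (h : A → ℕ) → ∑[ x ∈ xs ++ ys ] h x ≡ ∑[ x ∈ xs ] h x + ∑[ y ∈ ys ] h y
  ∑ₗ-++ []       ys h = refl
  ∑ₗ-++ (x ∷ xs) ys h = trans (cong (h x +_) (∑ₗ-++ xs ys h)) (sym (ℕₚ.+-assoc (h x) _ _))

  ∑ₗ-map : (g : A → B) (xs : List A) (h : B → ℕ) → ∑[ y ∈ map g xs ] h y ≡ ∑[ x ∈ xs ] h (g x)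
  ∑ₗ-map g []       h = refl
  ∑ₗ-map g (x ∷ xs) h = cong (h (g x) +_) (∑ₗ-map g xs h)

  ∑ₗ-concatMap : (g : A → List B) (xs : List A) (h : B → ℕ) →
                 ∑[ y ∈ concatMap g xs ] h y ≡ ∑[ x ∈ xs ] ∑[ y ∈ g x ] h y
  ∑ₗ-concatMap g []       h = refl
  ∑ₗ-concatMap g (x ∷ xs) h = trans (∑ₗ-++ (g x) (concatMap g xs) h) (cong (sumOver (g x) h +_) (∑ₗ-concatMap g xs h))

  ∑ₗ-allFin : ∀ {n} (h : Fin n → ℕ) → ∑[ i ∈ allFin n ] h i ≡ ∑[ i < n ] h i
  ∑ₗ-allFin {n} h = go (λ i → i)
    where
      go : ∀ {k} (g : Fin k → Fin n) → ∑[ i ∈ List.tabulate g ] h i ≡ ∑[ i < k ] h (g i)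
      go {zero}  g = refl
      go {suc k} g = cong (h (g zero) +_) (go (λ i → g (suc i)))

  sum-map≡∑ₗ : (f : A → ℕ) (xs : List A) → ListAction.sum (map f xs) ≡ ∑[ x ∈ xs ] f x
  sum-map≡∑ₗ f []       = refl
  sum-map≡∑ₗ f (x ∷ xs) = cong (f x +_) (sum-map≡∑ₗ f xs)

  sumFin≡sum : ∀ {n} (f : Fin n → ℕ) → sumFin f ≡ sum f
  sumFin≡sum {n} f = trans (sum-map≡∑ₗ f (allFin n)) (∑ₗ-allFin f)

  ∑≡0⇒≡0 : ∀ {n} (f : Fin n → ℕ) → sum f ≡ 0 → ∀ i → f i ≡ 0
  ∑≡0⇒≡0 f ∑f≡0 zero    = ℕₚ.m+n≡0⇒m≡0 (f zero) ∑f≡0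
  ∑≡0⇒≡0 f ∑f≡0 (suc i) = ∑≡0⇒≡0 (λ j → f (suc j)) (ℕₚ.m+n≡0⇒n≡0 (f zero) ∑f≡0) i

  ∑-pos⇒∃-pos : ∀ {n} (f : Fin n → ℕ) → 1 ≤ sum f → Σ (Fin n) (λ i → 1 ≤ f i)
  ∑-pos⇒∃-pos {suc n} f 1≤∑f with f zero in f₀
  ... | suc _ = zero , subst (1 ≤_) (sym f₀) (s≤s z≤n)
  ... | zero with ∑-pos⇒∃-pos (λ j → f (suc j)) 1≤∑f
  ...   | i , 1≤fᵢ = suc i , 1≤fᵢ

  ∸-suc : ∀ {k n} → suc k ≤ n → n ∸ k ≡ suc (n ∸ suc k)
  ∸-suc {zero}  {suc n} _         = refl
  ∸-suc {suc k} {suc n} (s≤s k<n) = ∸-suc k<n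

  ∑-∑-*ʳ : ∀ {m n} (c : ℕ) (h : Fin m → Fin n → ℕ) → ∑[ i < m ] ∑[ j < n ] (h i j * c) ≡ (∑[ i < m ] ∑[ j < n ] h i j) * c
  ∑-∑-*ʳ c h = trans (sum-cong-≗ λ i → sym (*-distribʳ-sum c (h i))) (sym (*-distribʳ-sum c (λ i → sum (h i))))

  ∑-∑-δ-δ : ∀ {m n} (a : Fin m) (b : Fin n) (h : Fin m → Fin n → ℕ) → ∑[ i < m ] ∑[ j < n ] (h i j * (δ i a * δ j b)) ≡ h a b
  ∑-∑-δ-δ {m} {n} a b h = begin
    ∑[ i < m ] ∑[ j < n ] (h i j * (δ i a * δ j b))   ≡⟨ ∑-∑-cong (λ i j → rearrange (h i j) (δ i a) (δ j b)) ⟩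
    ∑[ i < m ] ∑[ j < n ] (δ i a * (δ j b * h i j))   ≡⟨ sum-cong-≗ (λ i → sym (*-distribˡ-sum (δ i a) (λ j → δ j b * h i j))) ⟩
    ∑[ i < m ] (δ i a * ∑[ j < n ] (δ j b * h i j))   ≡⟨ sum-cong-≗ (λ i → cong (δ i a *_) (∑-δ b (h i))) ⟩
    ∑[ i < m ] (δ i a * h i b)                        ≡⟨ ∑-δ a (λ i → h i b) ⟩
    h a b                                             ∎
    where
      open ≡-Reasoning
      rearrange : ∀ x y z → x * (y * z) ≡ y * (z * x)
      rearrange = solve-∀

  ∑ₗ-∑-∑-comm : ∀ {m n} (xs : List A) (h : A → Fin m → Fin n → ℕ) →
                ∑[ x ∈ xs ] ∑[ i < m ] ∑[ j < n ] h x i j ≡ ∑[ i < m ] ∑[ j < n ] ∑[ x ∈ xs ] h x i j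
  ∑ₗ-∑-∑-comm xs h = trans (∑ₗ-∑-comm xs (λ x i → ∑[ j < _ ] h x i j)) (sum-cong-≗ λ i → ∑ₗ-∑-comm xs (λ x → h x i))

  ∑ₗ-weighted : ∀ {m n} (xs : List A) (w : Fin m → Fin n → ℕ) (h : A → Fin m → Fin n → ℕ) →
                ∑[ x ∈ xs ] ∑[ i < m ] ∑[ j < n ] (w i j * h x i j) ≡ ∑[ i < m ] ∑[ j < n ] (w i j * ∑[ x ∈ xs ] h x i j)
  ∑ₗ-weighted xs w h = trans (∑ₗ-∑-∑-comm xs (λ x i j → w i j * h x i j)) (∑-∑-cong λ i j → ∑ₗ-*ˡ xs (w i j) (λ x → h x i j))

  ∑-∑-weighted-*ˡ : ∀ {m n} (c : ℕ) (w h : Fin m → Fin n → ℕ) →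
                    c * ∑[ i < m ] ∑[ j < n ] (w i j * h i j) ≡ ∑[ i < m ] ∑[ j < n ] (w i j * (c * h i j))
  ∑-∑-weighted-*ˡ c w h = trans (sym (∑-∑-*ˡ c (λ i j → w i j * h i j))) (∑-∑-cong λ i j → rearrange c (w i j) (h i j))
    where
      rearrange : ∀ x y z → x * (y * z) ≡ y * (x * z)
      rearrange = solve-∀

  ∑-mono-≤ : ∀ {n} {f g : Fin n → ℕ} → (∀ i → f i ≤ g i) → sum f ≤ sum g
  ∑-mono-≤ {zero}  f≤g = ℕₚ.≤-refl
  ∑-mono-≤ {suc n} f≤g = ℕₚ.+-mono-≤ (f≤g zero) (∑-mono-≤ (λ i → f≤g (suc i)))

  term≤∑ : ∀ {n} (f : Fin n → ℕ) i → f i ≤ sum f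
  term≤∑ f zero    = ℕₚ.m≤m+n (f zero) _
  term≤∑ f (suc i) = ℕₚ.≤-trans (term≤∑ (λ j → f (suc j)) i) (ℕₚ.m≤n+m _ (f zero))

  module _ {s : ℕ} where

    δ≤ : (e : Fin s → ℕ) {i : Fin s} → 1 ≤ e i → ∀ a → δ i a ≤ e a
    δ≤ e {i} 1≤eᵢ a with i Fin.≟ a
    ... | yes refl = 1≤eᵢ
    ... | no _     = z≤n

    _+δ_ _∸δ_ : (Fin s → ℕ) → Fin s → Fin s → ℕ
    (e +δ a) b = e b + δ a b
    (e ∸δ a) b = e b ∸ δ a b

    fiberSize≡∑ : ∀ {n} (f : Fin n → Fin s) a → fiberSize f a ≡ ∑[ v < n ] δ (f v) a
    fiberSize≡∑ {n} f a = trans (length-filter≡∑ₗ (λ v → f v Fin.≟ a) (allFin n)) (∑ₗ-allFin (λ v → δ (f v) a))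

    fiberSize-∷ : ∀ {n} i (g : Fin n → Fin s) a → fiberSize (i Vector.∷ g) a ≡ δ i a + fiberSize g a
    fiberSize-∷ i g a = trans (fiberSize≡∑ (i Vector.∷ g) a) (cong (δ i a +_) (sym (fiberSize≡∑ g a)))

    hasFibers? : ∀ {n} (f : Fin n → Fin s) (d : Fin s → ℕ) → Dec (∀ a → fiberSize f a ≡ d a)
    hasFibers? f d = all? (λ a → fiberSize f a ℕ.≟ d a)

    hasFibers-cong : ∀ {n} (f : Fin n → Fin s) {d d′ : Fin s → ℕ} → (∀ a → d a ≡ d′ a) →
                     𝟙 (hasFibers? f d) ≡ 𝟙 (hasFibers? f d′)
    hasFibers-cong f d≗d′ = 𝟙-cong (mk⇔ (λ h a → trans (h a) (d≗d′ a)) (λ h a → trans (h a) (sym (d≗d′ a))))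
                                   (hasFibers? f _) (hasFibers? f _)

    hasFibers-value : ∀ {n} (f : Fin n → Fin s) d a → 𝟙 (hasFibers? f d) * d a ≡ 𝟙 (hasFibers? f d) * fiberSize f a
    hasFibers-value f d a with hasFibers? f d
    ... | yes h = cong (1 *_) (sym (h a))
    ... | no _  = refl

    hasFibers-∷ : ∀ {n} i (g : Fin n → Fin s) d →
                  𝟙 (hasFibers? (i Vector.∷ g) d) ≡ 𝟙 (1 ≤? d i) * 𝟙 (hasFibers? g (d ∸δ i))
    hasFibers-∷ i g d = trans (𝟙-cong (mk⇔ to from) (hasFibers? (i Vector.∷ g) d) (1 ≤? d i ×-dec hasFibers? g (d ∸δ i)))
                              (𝟙-× (1 ≤? d i) (hasFibers? g (d ∸δ i)))
      where
        to : (∀ a → fiberSize (i Vector.∷ g) a ≡ d a) → 1 ≤ d i × (∀ a → fiberSize g a ≡ (d ∸δ i) a)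
        to h = subst (1 ≤_) (trans (sym (fiberSize-∷ i g i)) (h i)) (subst (λ k → 1 ≤ k + fiberSize g i) (sym (δ-refl i)) (s≤s z≤n))
             , λ a → sym (trans (cong (_∸ δ i a) (trans (sym (h a)) (fiberSize-∷ i g a))) (ℕₚ.m+n∸m≡n (δ i a) (fiberSize g a)))
        from : 1 ≤ d i × (∀ a → fiberSize g a ≡ (d ∸δ i) a) → ∀ a → fiberSize (i Vector.∷ g) a ≡ d a
        from (1≤dᵢ , h) a = trans (fiberSize-∷ i g a) (trans (cong (δ i a +_) (h a)) (ℕₚ.m+[n∸m]≡n (δ≤ d 1≤dᵢ a)))

    ∑-allMaps-suc : ∀ {n} (h : (Fin (suc n) → Fin s) → ℕ) →
                    ∑[ f ∈ allMaps (suc n) s ] h f ≡ ∑[ g ∈ allMaps n s ] ∑[ i < s ] h (i Vector.∷ g)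
    ∑-allMaps-suc {n} h =
      trans (∑ₗ-concatMap (λ g → map (λ i → i Vector.∷ g) (allFin s)) (allMaps n s) h)
            (∑ₗ-cong (allMaps n s) λ g → trans (∑ₗ-map (λ i → i Vector.∷ g) (allFin s) h) (∑ₗ-allFin (λ i → h (i Vector.∷ g))))

    Partial : ℕ → Set
    Partial n = Fin n → Maybe (Fin s)

    empty : ∀ {n} → Partial n
    empty _ = nothing

    _[_↦_] : ∀ {n} → Partial n → Fin n → Fin s → Partial n
    p [ v ↦ a ] = updateAt p v (λ _ → just a)

    compatible : Fin s → Maybe (Fin s) → ℕ
    compatible x nothing  = 1
    compatible x (just a) = δ x a

    agrees : ∀ {n} → (Fin n → Fin s) → Partial n → ℕ
    agrees {zero}  f p = 1
    agrees {suc n} f p = compatible (f zero) (p zero) * agrees (λ w → f (suc w)) (λ w → p (suc w))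

    assigned : Maybe (Fin s) → ℕ
    assigned nothing  = 0
    assigned (just _) = 1

    assignedTo : Fin s → Maybe (Fin s) → ℕ
    assignedTo a nothing  = 0
    assignedTo a (just b) = δ b a

    size : ∀ {n} → Partial n → ℕ
    size {n} p = ∑[ w < n ] assigned (p w)

    multiplicity : ∀ {n} → Partial n → Fin s → ℕ
    multiplicity {n} p a = ∑[ w < n ] assignedTo a (p w)

    agrees-empty : ∀ {n} (f : Fin n → Fin s) → agrees f empty ≡ 1
    agrees-empty {zero}  f = refl
    agrees-empty {suc n} f = trans (ℕₚ.+-identityʳ _) (agrees-empty (λ w → f (suc w)))

    size≤ : ∀ {n} (p : Partial n) → size p ≤ n
    size≤ {zero}  p = z≤n
    size≤ {suc n} p with p zero
    ... | nothing = ℕₚ.m≤n⇒m≤1+n (size≤ (λ w → p (suc w)))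
    ... | just _  = s≤s (size≤ (λ w → p (suc w)))

    ∑-[↦] : ∀ {n} (φ : Maybe (Fin s) → ℕ) → φ nothing ≡ 0 → (p : Partial n) (v : Fin n) (a : Fin s) → p v ≡ nothing →
            ∑[ w < n ] φ ((p [ v ↦ a ]) w) ≡ φ (just a) + ∑[ w < n ] φ (p w)
    ∑-[↦] {suc n} φ φ₀ p zero    a pᵥ =
      sym (cong (λ k → φ (just a) + (k + ∑[ w < n ] φ (p (suc w)))) (trans (cong φ pᵥ) φ₀))
    ∑-[↦] {suc n} φ φ₀ p (suc v) a pᵥ =
      trans (cong (φ (p zero) +_) (∑-[↦] φ φ₀ (λ w → p (suc w)) v a pᵥ)) (swap (φ (p zero)) (φ (just a)) _)
      where
        swap : ∀ x y z → x + (y + z) ≡ y + (x + z)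
        swap = solve-∀

    size-[↦] : ∀ {n} (p : Partial n) v a → p v ≡ nothing → size (p [ v ↦ a ]) ≡ suc (size p)
    size-[↦] p v a pᵥ = ∑-[↦] assigned refl p v a pᵥ

    multiplicity-[↦] : ∀ {n} (p : Partial n) v a → p v ≡ nothing → ∀ b → multiplicity (p [ v ↦ a ]) b ≡ δ a b + multiplicity p b
    multiplicity-[↦] p v a pᵥ b = ∑-[↦] (assignedTo b) refl p v a pᵥ

    agrees-[↦] : ∀ {n} (f : Fin n → Fin s) (p : Partial n) v a → p v ≡ nothing → agrees f (p [ v ↦ a ]) ≡ δ (f v) a * agrees f p
    agrees-[↦] f p zero    a pᵥ =
      sym (cong (δ (f zero) a *_) (trans (cong (λ x → compatible (f zero) x * agrees (λ w → f (suc w)) (λ w → p (suc w))) pᵥ)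
                                         (ℕₚ.*-identityˡ _)))
    agrees-[↦] f p (suc v) a pᵥ = trans (cong (compatible (f zero) (p zero) *_) (agrees-[↦] (λ w → f (suc w)) (λ w → p (suc w)) v a pᵥ))
                                        (swap (compatible (f zero) (p zero)) (δ (f (suc v)) a) _)
      where
        swap : ∀ x y z → x * (y * z) ≡ y * (x * z)
        swap = solve-∀

    extensions : (n : ℕ) → (Fin s → ℕ) → Partial n → ℕ
    extensions n d p = ∑[ f ∈ allMaps n s ] (𝟙 (hasFibers? f d) * agrees f p)

    multinomial : ℕ → (Fin s → ℕ) → ℕ
    multinomial r e = extensions r e empty

    extensions-cong : ∀ n {d d′} (p : Partial n) → (∀ a → d a ≡ d′ a) → extensions n d p ≡ extensions n d′ p
    extensions-cong n p d≗d′ = ∑ₗ-cong (allMaps n s) λ f → cong (_* agrees f p) (hasFibers-cong f d≗d′)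

    extensions-suc : ∀ n d (p : Partial (suc n)) →
      extensions (suc n) d p ≡ ∑[ i < s ] (compatible i (p zero) * (𝟙 (1 ≤? d i) * extensions n (d ∸δ i) (λ w → p (suc w))))
    extensions-suc n d p = begin
      extensions (suc n) d p
        ≡⟨ ∑-allMaps-suc (λ f → 𝟙 (hasFibers? f d) * agrees f p) ⟩
      ∑[ g ∈ allMaps n s ] ∑[ i < s ] (𝟙 (hasFibers? (i Vector.∷ g) d) * (compatible i (p zero) * agrees g p′))
        ≡⟨ ∑ₗ-cong (allMaps n s) (λ g → sum-cong-≗ λ i →
             trans (cong (_* (compatible i (p zero) * agrees g p′)) (hasFibers-∷ i g d))
                   (rearrange (𝟙 (1 ≤? d i)) (𝟙 (hasFibers? g (d ∸δ i))) (compatible i (p zero)) (agrees g p′))) ⟩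
      ∑[ g ∈ allMaps n s ] ∑[ i < s ] (compatible i (p zero) * (𝟙 (1 ≤? d i) * (𝟙 (hasFibers? g (d ∸δ i)) * agrees g p′)))
        ≡⟨ ∑ₗ-∑-comm (allMaps n s) (λ g i → compatible i (p zero) * (𝟙 (1 ≤? d i) * (𝟙 (hasFibers? g (d ∸δ i)) * agrees g p′))) ⟩
      ∑[ i < s ] ∑[ g ∈ allMaps n s ] (compatible i (p zero) * (𝟙 (1 ≤? d i) * (𝟙 (hasFibers? g (d ∸δ i)) * agrees g p′)))
        ≡⟨ sum-cong-≗ (λ i → trans (∑ₗ-*ˡ (allMaps n s) (compatible i (p zero)) _)
                                   (cong (compatible i (p zero) *_) (∑ₗ-*ˡ (allMaps n s) (𝟙 (1 ≤? d i)) _))) ⟩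
      ∑[ i < s ] (compatible i (p zero) * (𝟙 (1 ≤? d i) * extensions n (d ∸δ i) p′)) ∎
      where
        open ≡-Reasoning
        p′ : Partial n
        p′ w = p (suc w)
        rearrange : ∀ x y c a → (x * y) * (c * a) ≡ c * (x * (y * a))
        rearrange = solve-∀

    extensions-just : ∀ n d (p : Partial (suc n)) {b} → p zero ≡ just b →
      extensions (suc n) d p ≡ 𝟙 (1 ≤? d b) * extensions n (d ∸δ b) (λ w → p (suc w))
    extensions-just n d p {b} p₀ =
      trans (extensions-suc n d p)
            (trans (sum-cong-≗ λ i → cong (λ x → compatible i x * (𝟙 (1 ≤? d i) * extensions n (d ∸δ i) (λ w → p (suc w)))) p₀)
                   (∑-δ b (λ i → 𝟙 (1 ≤? d i) * extensions n (d ∸δ i) (λ w → p (suc w)))))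

    extensions-nothing : ∀ n d (p : Partial (suc n)) → p zero ≡ nothing →
      extensions (suc n) d p ≡ ∑[ i < s ] (𝟙 (1 ≤? d i) * extensions n (d ∸δ i) (λ w → p (suc w)))
    extensions-nothing n d p p₀ =
      trans (extensions-suc n d p)
            (sum-cong-≗ λ i → trans (cong (λ x → compatible i x * (𝟙 (1 ≤? d i) * extensions n (d ∸δ i) (λ w → p (suc w)))) p₀)
                                    (ℕₚ.*-identityˡ _))

    extensions-≡-0 : ∀ n d (p : Partial n) a → d a < multiplicity p a → extensions n d p ≡ 0
    extensions-≡-0 (suc n) d p a dₐ<mₐ = by-cases (p zero) refl
      where
        p′ : Partial n
        p′ w = p (suc w)
        by-cases : (x : Maybe (Fin s)) → p zero ≡ x → extensions (suc n) d p ≡ 0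
        by-cases (just b) p₀ = trans (extensions-just n d p p₀) (vanish (1 ≤? d b))
          where
            dₐ<δ+m′ : d a < δ b a + multiplicity p′ a
            dₐ<δ+m′ = subst (λ x → d a < assignedTo a x + multiplicity p′ a) p₀ dₐ<mₐ
            vanish : (x : Dec (1 ≤ d b)) → 𝟙 x * extensions n (d ∸δ b) p′ ≡ 0
            vanish (no _)      = refl
            vanish (yes 1≤d_b) = trans (ℕₚ.+-identityʳ _) (extensions-≡-0 n (d ∸δ b) p′ a
              (ℕₚ.+-cancelˡ-< (δ b a) _ _ (subst (_< δ b a + multiplicity p′ a) (sym (ℕₚ.m+[n∸m]≡n (δ≤ d 1≤d_b a))) dₐ<δ+m′)))
        by-cases nothing p₀ = trans (extensions-nothing n d p p₀)
          (trans (sum-cong-≗ λ i → cong (𝟙 (1 ≤? d i) *_) (extensions-≡-0 n (d ∸δ i) p′ a (ℕₚ.≤-<-trans (ℕₚ.m∸n≤m (d a) (δ i a)) dₐ<m′)))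
                 (trans (sum-cong-≗ λ i → ℕₚ.*-zeroʳ (𝟙 (1 ≤? d i))) (sum-replicate-zero s)))
          where
            dₐ<m′ : d a < multiplicity p′ a
            dₐ<m′ = subst (λ x → d a < assignedTo a x + multiplicity p′ a) p₀ dₐ<mₐ

    extensions-≡-multinomial : ∀ n d e (p : Partial n) → (∀ a → d a ≡ e a + multiplicity p a) →
                               extensions n d p ≡ multinomial (n ∸ size p) e
    extensions-≡-multinomial zero    d e p d≡ = extensions-cong 0 p (λ a → trans (d≡ a) (ℕₚ.+-identityʳ (e a)))
    extensions-≡-multinomial (suc n) d e p d≡ = by-cases (p zero) refl
      where
        open ≡-Reasoning
        p′ : Partial n
        p′ w = p (suc w)
        by-cases : (x : Maybe (Fin s)) → p zero ≡ x → extensions (suc n) d p ≡ multinomial (suc n ∸ size p) e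
        by-cases (just b) p₀ = begin
            extensions (suc n) d p                    ≡⟨ extensions-just n d p p₀ ⟩
            𝟙 (1 ≤? d b) * extensions n (d ∸δ b) p′   ≡⟨ cong (_* extensions n (d ∸δ b) p′) (𝟙-yes (1 ≤? d b) 1≤d_b) ⟩
            1 * extensions n (d ∸δ b) p′              ≡⟨ ℕₚ.*-identityˡ _ ⟩
            extensions n (d ∸δ b) p′                  ≡⟨ extensions-≡-multinomial n (d ∸δ b) e p′ d∸δ≡ ⟩
            multinomial (n ∸ size p′) e               ≡⟨ cong (λ x → multinomial (suc n ∸ (assigned x + size p′)) e) (sym p₀) ⟩
            multinomial (suc n ∸ size p) e            ∎
          where
            swap : ∀ x y z → x + (y + z) ≡ y + (x + z)
            swap = solve-∀
            d≡′ : ∀ a → d a ≡ δ b a + (e a + multiplicity p′ a)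
            d≡′ a = trans (d≡ a) (trans (cong (λ x → e a + (assignedTo a x + multiplicity p′ a)) p₀) (swap (e a) (δ b a) _))
            1≤d_b : 1 ≤ d b
            1≤d_b = subst (1 ≤_) (sym (trans (d≡′ b) (cong (_+ (e b + multiplicity p′ b)) (δ-refl b)))) (s≤s z≤n)
            d∸δ≡ : ∀ a → d a ∸ δ b a ≡ e a + multiplicity p′ a
            d∸δ≡ a = trans (cong (_∸ δ b a) (d≡′ a)) (ℕₚ.m+n∸m≡n (δ b a) _)
        by-cases nothing p₀ = begin
            extensions (suc n) d p
              ≡⟨ extensions-nothing n d p p₀ ⟩
            ∑[ i < s ] (𝟙 (1 ≤? d i) * extensions n (d ∸δ i) p′)
              ≡⟨ sum-cong-≗ term ⟩
            ∑[ i < s ] (𝟙 (1 ≤? e i) * multinomial (n ∸ size p′) (e ∸δ i))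
              ≡⟨ sym (extensions-nothing (n ∸ size p′) e empty refl) ⟩
            multinomial (suc (n ∸ size p′)) e
              ≡⟨ cong (λ k → multinomial k e) (sym (ℕₚ.+-∸-assoc 1 (size≤ p′))) ⟩
            multinomial (suc n ∸ size p′) e
              ≡⟨ cong (λ x → multinomial (suc n ∸ (assigned x + size p′)) e) (sym p₀) ⟩
            multinomial (suc n ∸ size p) e ∎
          where
            d≡′ : ∀ a → d a ≡ e a + multiplicity p′ a
            d≡′ a = trans (d≡ a) (cong (λ x → e a + (assignedTo a x + multiplicity p′ a)) p₀)
            term : ∀ i → 𝟙 (1 ≤? d i) * extensions n (d ∸δ i) p′ ≡ 𝟙 (1 ≤? e i) * multinomial (n ∸ size p′) (e ∸δ i)
            term i with 1 ≤? e i
            ... | yes 1≤eᵢ =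
              trans (cong (_* extensions n (d ∸δ i) p′) (𝟙-yes (1 ≤? d i) (ℕₚ.≤-trans 1≤eᵢ (subst (e i ≤_) (sym (d≡′ i)) (ℕₚ.m≤m+n (e i) _)))))
                    (cong (1 *_) (extensions-≡-multinomial n (d ∸δ i) (e ∸δ i) p′
                                    (λ a → trans (cong (_∸ δ i a) (d≡′ a)) (ℕₚ.+-∸-comm (multiplicity p′ a) (δ≤ e 1≤eᵢ a)))))
            ... | no 1≰eᵢ = vanish (1 ≤? d i)
              where
                dᵢ≡ : d i ≡ multiplicity p′ i
                dᵢ≡ = trans (d≡′ i) (cong (_+ multiplicity p′ i) (ℕₚ.n<1⇒n≡0 (ℕₚ.≰⇒> 1≰eᵢ)))
                vanish : (x : Dec (1 ≤ d i)) → 𝟙 x * extensions n (d ∸δ i) p′ ≡ 0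
                vanish (no _)     = refl
                vanish (yes 1≤dᵢ) = trans (ℕₚ.+-identityʳ _) (extensions-≡-0 n (d ∸δ i) p′ i
                  (subst (λ k → d i ∸ k < multiplicity p′ i) (sym (δ-refl i))
                         (subst (d i ∸ 1 <_) dᵢ≡ (ℕₚ.∸-monoʳ-< {o = 0} (s≤s z≤n) 1≤dᵢ))))

    size-empty : ∀ {n} → size (empty {n}) ≡ 0
    size-empty {n} = sum-replicate-zero n

    multiplicity-empty : ∀ {n} a → multiplicity (empty {n}) a ≡ 0
    multiplicity-empty {n} a = sum-replicate-zero n

    -- Double counting of the pairs (f , v) with f a map of fiber sizes e +δ a and f v ≡ a.
    multinomial-suc : ∀ r e a → suc r * multinomial r e ≡ suc (e a) * multinomial (suc r) (e +δ a)
    multinomial-suc r e a = sym (begin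
        suc (e a) * multinomial (suc r) d
          ≡⟨ cong (_* multinomial (suc r) d) (sym dₐ) ⟩
        d a * multinomial (suc r) d
          ≡⟨ sym (∑ₗ-*ˡ (allMaps (suc r) s) (d a) (λ f → 𝟙 (hasFibers? f d) * agrees f empty)) ⟩
        ∑[ f ∈ allMaps (suc r) s ] (d a * (𝟙 (hasFibers? f d) * agrees f empty))
          ≡⟨ ∑ₗ-cong (allMaps (suc r) s) count-colour-a ⟩
        ∑[ f ∈ allMaps (suc r) s ] ∑[ v < suc r ] (𝟙 (hasFibers? f d) * agrees f (single v))
          ≡⟨ ∑ₗ-∑-comm (allMaps (suc r) s) (λ f v → 𝟙 (hasFibers? f d) * agrees f (single v)) ⟩
        ∑[ v < suc r ] extensions (suc r) d (single v)
          ≡⟨ sum-cong-≗ (λ v → extensions-≡-multinomial (suc r) d e (single v) (d≡ v)) ⟩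
        ∑[ v < suc r ] multinomial (suc r ∸ size (single v)) e
          ≡⟨ sum-cong-≗ (λ v → cong (λ k → multinomial (suc r ∸ k) e) (trans (size-[↦] (empty {suc r}) v a refl) (cong suc (size-empty {suc r})))) ⟩
        ∑[ v < suc r ] multinomial r e
          ≡⟨ ∑-const (suc r) (multinomial r e) ⟩
        suc r * multinomial r e ∎)
      where
        open ≡-Reasoning
        d = e +δ a
        single : Fin (suc r) → Partial (suc r)
        single v = empty [ v ↦ a ]
        dₐ : d a ≡ suc (e a)
        dₐ = trans (cong (e a +_) (δ-refl a)) (ℕₚ.+-comm (e a) 1)
        d≡ : ∀ v b → d b ≡ e b + multiplicity (single v) b
        d≡ v b = cong (e b +_) (sym (trans (multiplicity-[↦] (empty {suc r}) v a refl b) (trans (cong (δ a b +_) (multiplicity-empty {suc r} b)) (ℕₚ.+-identityʳ _))))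
        count-colour-a : ∀ f → d a * (𝟙 (hasFibers? f d) * agrees f empty) ≡ ∑[ v < suc r ] (𝟙 (hasFibers? f d) * agrees f (single v))
        count-colour-a f = begin
          d a * (𝟙 (hasFibers? f d) * agrees f empty)      ≡⟨ cong (λ k → d a * (𝟙 (hasFibers? f d) * k)) (agrees-empty f) ⟩
          d a * (𝟙 (hasFibers? f d) * 1)                   ≡⟨ cong (d a *_) (ℕₚ.*-identityʳ _) ⟩
          d a * 𝟙 (hasFibers? f d)                         ≡⟨ ℕₚ.*-comm (d a) _ ⟩
          𝟙 (hasFibers? f d) * d a                         ≡⟨ hasFibers-value f d a ⟩
          𝟙 (hasFibers? f d) * fiberSize f a               ≡⟨ cong (𝟙 (hasFibers? f d) *_) (fiberSize≡∑ f a) ⟩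
          𝟙 (hasFibers? f d) * ∑[ v < suc r ] δ (f v) a    ≡⟨ *-distribˡ-sum (𝟙 (hasFibers? f d)) (λ v → δ (f v) a) ⟩
          ∑[ v < suc r ] (𝟙 (hasFibers? f d) * δ (f v) a)  ≡⟨ sum-cong-≗ (λ v → cong (𝟙 (hasFibers? f d) *_) (sym (agrees-single v))) ⟩
          ∑[ v < suc r ] (𝟙 (hasFibers? f d) * agrees f (single v)) ∎
          where
            agrees-single : ∀ v → agrees f (single v) ≡ δ (f v) a
            agrees-single v = trans (agrees-[↦] f empty v a refl) (trans (cong (δ (f v) a *_) (agrees-empty f)) (ℕₚ.*-identityʳ _))

    multinomial-pos : ∀ n (e : Fin s → ℕ) → sum e ≡ n → 1 ≤ multinomial n e
    multinomial-pos zero    e ∑e≡0 =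
      subst (1 ≤_) (sym (∑ₗ-cong (allMaps 0 s) (λ f → trans (ℕₚ.*-identityʳ _) (𝟙-yes (hasFibers? f e) (λ a → sym (∑≡0⇒≡0 e ∑e≡0 a)))))) (s≤s z≤n)
    multinomial-pos (suc n) e ∑e≡1+n with ∑-pos⇒∃-pos e (subst (1 ≤_) (sym ∑e≡1+n) (s≤s z≤n))
    ... | a , 1≤eₐ = positive (multinomial (suc n) e) refl
      where
        e′ : Fin s → ℕ
        e′ = e ∸δ a
        e′+δ≗e : ∀ b → (e′ +δ a) b ≡ e b
        e′+δ≗e b = ℕₚ.m∸n+n≡m (δ≤ e 1≤eₐ b)
        ∑e′ : sum e′ ≡ n
        ∑e′ = ℕₚ.+-cancelʳ-≡ 1 (sum e′) n (begin
          sum e′ + 1                ≡⟨ cong (sum e′ +_) (sym (trans (∑-δ′ a (λ _ → 1)) refl)) ⟩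
          sum e′ + ∑[ b < s ] (δ a b * 1) ≡⟨ cong (sum e′ +_) (sum-cong-≗ λ b → ℕₚ.*-identityʳ (δ a b)) ⟩
          sum e′ + sum (δ a)        ≡⟨ sym (∑-distrib-+ e′ (δ a)) ⟩
          sum (e′ +δ a)             ≡⟨ sum-cong-≗ e′+δ≗e ⟩
          sum e                     ≡⟨ trans ∑e≡1+n (ℕₚ.+-comm 1 n) ⟩
          n + 1                     ∎)
          where open ≡-Reasoning
        positive : ∀ k → multinomial (suc n) e ≡ k → 1 ≤ k
        positive (suc k) _ = s≤s z≤n
        positive zero    Q≡0 = ⊥-elim (ℕₚ.<-irrefl refl (subst (1 ≤_) vanishes
                                  (ℕₚ.*-mono-≤ (s≤s (z≤n {n})) (multinomial-pos n e′ ∑e′))))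
          where
            vanishes : suc n * multinomial n e′ ≡ 0
            vanishes = trans (multinomial-suc n e′ a)
                             (trans (cong (suc (e′ a) *_) (trans (extensions-cong (suc n) empty e′+δ≗e) Q≡0)) (ℕₚ.*-zeroʳ (suc (e′ a))))

    private
      extensions-[↦]-fits : ∀ n d (p : Partial n) v a (pᵥ : p v ≡ nothing) → (∀ b → multiplicity (p [ v ↦ a ]) b ≤ d b) →
                            (n ∸ size p) * extensions n d (p [ v ↦ a ]) ≡ (d a ∸ multiplicity p a) * extensions n d p
      extensions-[↦]-fits n d p v a pᵥ m′≤d = begin
          (n ∸ size p) * extensions n d p′          ≡⟨ cong₂ _*_ n∸size (extensions-≡-multinomial n d e p′ d≡e+m′) ⟩
          suc r * multinomial (n ∸ size p′) e       ≡⟨ cong (λ k → suc r * multinomial (n ∸ k) e) (size-[↦] p v a pᵥ) ⟩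
          suc r * multinomial r e                   ≡⟨ multinomial-suc r e a ⟩
          suc (e a) * multinomial (suc r) (e +δ a)  ≡⟨ cong₂ _*_ (sym dₐ∸mₐ) (sym (trans (extensions-≡-multinomial n d (e +δ a) p d≡e+δ+m)
                                                                                         (cong (λ k → multinomial k (e +δ a)) n∸size))) ⟩
          (d a ∸ multiplicity p a) * extensions n d p ∎
        where
          open ≡-Reasoning
          p′ = p [ v ↦ a ]
          r = n ∸ suc (size p)
          e : Fin s → ℕ
          e b = d b ∸ multiplicity p′ b
          d≡e+m′ : ∀ b → d b ≡ e b + multiplicity p′ b
          d≡e+m′ b = sym (ℕₚ.m∸n+n≡m (m′≤d b))
          d≡e+δ+m : ∀ b → d b ≡ (e +δ a) b + multiplicity p b
          d≡e+δ+m b = trans (d≡e+m′ b) (trans (cong (e b +_) (multiplicity-[↦] p v a pᵥ b)) (sym (ℕₚ.+-assoc (e b) (δ a b) _)))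
          n∸size : n ∸ size p ≡ suc r
          n∸size = ∸-suc (subst (_≤ n) (size-[↦] p v a pᵥ) (size≤ p′))
          dₐ∸mₐ : d a ∸ multiplicity p a ≡ suc (e a)
          dₐ∸mₐ = trans (cong (_∸ multiplicity p a) (trans (d≡e+δ+m a) (trans (cong (λ k → e a + k + multiplicity p a) (δ-refl a))
                                                                       (cong (_+ multiplicity p a) (ℕₚ.+-comm (e a) 1)))))
                        (ℕₚ.m+n∸n≡m (suc (e a)) (multiplicity p a))

      extensions-[↦]-overfull : ∀ n d (p : Partial n) v a (pᵥ : p v ≡ nothing) b → d b < multiplicity (p [ v ↦ a ]) b →
                                (n ∸ size p) * extensions n d (p [ v ↦ a ]) ≡ (d a ∸ multiplicity p a) * extensions n d p
      extensions-[↦]-overfull n d p v a pᵥ b dᵦ<m′ᵦ =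
        trans (cong ((n ∸ size p) *_) (extensions-≡-0 n d (p [ v ↦ a ]) b dᵦ<m′ᵦ)) (trans (ℕₚ.*-zeroʳ (n ∸ size p)) (sym vanish))
        where
          vanish : (d a ∸ multiplicity p a) * extensions n d p ≡ 0
          vanish with a Fin.≟ b
          ... | yes refl = cong (_* extensions n d p) (ℕₚ.m≤n⇒m∸n≡0 (ℕₚ.≤-pred
                             (subst (d a <_) (trans (multiplicity-[↦] p v a pᵥ a) (cong (_+ multiplicity p a) (δ-refl a))) dᵦ<m′ᵦ)))
          ... | no a≢b   = trans (cong ((d a ∸ multiplicity p a) *_) (extensions-≡-0 n d p b
                             (subst (d b <_) (trans (multiplicity-[↦] p v a pᵥ b) (cong (_+ multiplicity p b) (𝟙-no (a Fin.≟ b) a≢b))) dᵦ<m′ᵦ)))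
                                 (ℕₚ.*-zeroʳ (d a ∸ multiplicity p a))

    -- Conditionally on extending p, a uniform map of fiber sizes d sends a further vertex v to a
    -- with probability (d a ∸ multiplicity p a) / (n ∸ size p).
    extensions-[↦] : ∀ n d (p : Partial n) v a → p v ≡ nothing →
                     (n ∸ size p) * extensions n d (p [ v ↦ a ]) ≡ (d a ∸ multiplicity p a) * extensions n d p
    extensions-[↦] n d p v a pᵥ with all? (λ b → multiplicity (p [ v ↦ a ]) b ≤? d b)
    ... | yes m′≤d = extensions-[↦]-fits n d p v a pᵥ m′≤d
    ... | no m′≰d with ¬∀⟶∃¬ s (λ b → multiplicity (p [ v ↦ a ]) b ≤ d b) (λ b → multiplicity (p [ v ↦ a ]) b ≤? d b) m′≰d
    ...   | b , m′ᵦ≰dᵦ = extensions-[↦]-overfull n d p v a pᵥ b (ℕₚ.≰⇒> m′ᵦ≰dᵦ)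

    assign : ∀ {n} → List (Fin n × Fin s) → Partial n
    assign []             = empty
    assign ((v , a) ∷ vs) = assign vs [ v ↦ a ]

    coloredAs : ∀ {n} → (Fin n → Fin s) → List (Fin n × Fin s) → ℕ
    coloredAs f []             = 1
    coloredAs f ((v , a) ∷ vs) = δ (f v) a * coloredAs f vs

    weight : ∀ {n} → (Fin s → ℕ) → List (Fin n × Fin s) → ℕ
    weight d []             = 1
    weight d ((v , a) ∷ vs) = (d a ∸ multiplicity (assign vs) a) * weight d vs

    assign-unassigned : ∀ {n} {v : Fin n} (vs : List (Fin n × Fin s)) → All (v ≢_) (map proj₁ vs) → assign vs v ≡ nothing
    assign-unassigned             []             []          = refl
    assign-unassigned {v = v} ((w , b) ∷ vs) (v≢w ∷ v∉vs) = trans (updateAt-minimal v w (assign vs) v≢w) (assign-unassigned vs v∉vs)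

    size-assign : ∀ {n} (vs : List (Fin n × Fin s)) → Unique (map proj₁ vs) → size (assign vs) ≡ length vs
    size-assign {n} []             _              = size-empty {n}
    size-assign     ((v , a) ∷ vs) (v∉vs ∷ uniq) =
      trans (size-[↦] (assign vs) v a (assign-unassigned vs v∉vs)) (cong suc (size-assign vs uniq))

    multiplicity-assign : ∀ {n} (vs : List (Fin n × Fin s)) → Unique (map proj₁ vs) → ∀ b →
                          multiplicity (assign vs) b ≡ ∑[ x ∈ vs ] δ (proj₂ x) b
    multiplicity-assign {n} []             _             b = multiplicity-empty {n} b
    multiplicity-assign     ((v , a) ∷ vs) (v∉vs ∷ uniq) b =
      trans (multiplicity-[↦] (assign vs) v a (assign-unassigned vs v∉vs) b) (cong (δ a b +_) (multiplicity-assign vs uniq b))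

    agrees-assign : ∀ {n} (f : Fin n → Fin s) (vs : List (Fin n × Fin s)) → Unique (map proj₁ vs) →
                    agrees f (assign vs) ≡ coloredAs f vs
    agrees-assign f []             _             = agrees-empty f
    agrees-assign f ((v , a) ∷ vs) (v∉vs ∷ uniq) =
      trans (agrees-[↦] f (assign vs) v a (assign-unassigned vs v∉vs)) (cong (δ (f v) a *_) (agrees-assign f vs uniq))

    extensions-assign : ∀ n d (vs : List (Fin n × Fin s)) → Unique (map proj₁ vs) →
                        ff n (length vs) * extensions n d (assign vs) ≡ multinomial n d * weight d vs
    extensions-assign n d []             _             = trans (ℕₚ.*-identityˡ _) (sym (ℕₚ.*-identityʳ _))
    extensions-assign n d ((v , a) ∷ vs) (v∉vs ∷ uniq) = begin
        ff n k * (n ∸ k) * extensions n d (p [ v ↦ a ])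
          ≡⟨ cong (λ j → ff n k * (n ∸ j) * extensions n d (p [ v ↦ a ])) (sym (size-assign vs uniq)) ⟩
        ff n k * (n ∸ size p) * extensions n d (p [ v ↦ a ])
          ≡⟨ ℕₚ.*-assoc (ff n k) _ _ ⟩
        ff n k * ((n ∸ size p) * extensions n d (p [ v ↦ a ]))
          ≡⟨ cong (ff n k *_) (extensions-[↦] n d p v a (assign-unassigned vs v∉vs)) ⟩
        ff n k * ((d a ∸ multiplicity p a) * extensions n d p)
          ≡⟨ rearrange (ff n k) (d a ∸ multiplicity p a) (extensions n d p) ⟩
        (d a ∸ multiplicity p a) * (ff n k * extensions n d p)
          ≡⟨ cong ((d a ∸ multiplicity p a) *_) (extensions-assign n d vs uniq) ⟩
        (d a ∸ multiplicity p a) * (multinomial n d * weight d vs)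
          ≡⟨ rearrange (d a ∸ multiplicity p a) (multinomial n d) (weight d vs) ⟩
        multinomial n d * weight d ((v , a) ∷ vs) ∎
      where
        open ≡-Reasoning
        k = length vs
        p = assign vs
        rearrange : ∀ x y z → x * (y * z) ≡ y * (x * z)
        rearrange = solve-∀

  module _ {n s : ℕ} (c : Composition n s) where

    private
      d : Fin s → ℕ
      d = Composition.part c

    numColorings : ℕ
    numColorings = length (colorings c)

    ∑-colorings : (g : (Fin n → Fin s) → ℕ) → ∑[ f ∈ colorings c ] g f ≡ ∑[ f ∈ allMaps n s ] (𝟙 (hasFibers? f d) * g f)
    ∑-colorings g = ∑ₗ-filter (λ f → hasFibers? f d) (allMaps n s) g

    numColorings≡multinomial : numColorings ≡ multinomial n d
    numColorings≡multinomial = trans (length≡∑ₗ (colorings c))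
      (trans (∑-colorings (λ _ → 1)) (∑ₗ-cong (allMaps n s) λ f → cong (𝟙 (hasFibers? f d) *_) (sym (agrees-empty f))))

    numColorings-pos : 1 ≤ numColorings
    numColorings-pos = subst (1 ≤_) (sym numColorings≡multinomial)
                             (multinomial-pos n d (trans (sym (sumFin≡sum d)) (Composition.sums c)))

    ∑-coloredAs : (vs : List (Fin n × Fin s)) → Unique (map proj₁ vs) →
                  ff n (length vs) * ∑[ f ∈ colorings c ] coloredAs f vs ≡ numColorings * weight d vs
    ∑-coloredAs vs uniq = begin
      ff n (length vs) * ∑[ f ∈ colorings c ] coloredAs f vs
        ≡⟨ cong (ff n (length vs) *_) (trans (∑-colorings (λ f → coloredAs f vs))
                                             (∑ₗ-cong (allMaps n s) λ f → cong (𝟙 (hasFibers? f d) *_) (sym (agrees-assign f vs uniq)))) ⟩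
      ff n (length vs) * extensions n d (assign vs)
        ≡⟨ extensions-assign n d vs uniq ⟩
      multinomial n d * weight d vs
        ≡⟨ cong (_* weight d vs) (sym numColorings≡multinomial) ⟩
      numColorings * weight d vs ∎
      where open ≡-Reasoning

    ∑-monochromatic : (us : List (Fin n)) (i : Fin s) → Unique us →
                      ff n (length us) * ∑[ f ∈ colorings c ] coloredAs f (map (_, i) us) ≡ numColorings * ff (d i) (length us)
    ∑-monochromatic us i uniq = trans (cong (λ k → ff n k * ∑[ f ∈ colorings c ] coloredAs f (map (_, i) us)) (sym (length-map (_, i) us)))
      (trans (∑-coloredAs (map (_, i) us) (unique-pairs us uniq))
             (cong (numColorings *_) (weight-monochromatic us uniq)))
      where
        map-proj₁ : (us : List (Fin n)) → map proj₁ (map (_, i) us) ≡ us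
        map-proj₁ []       = refl
        map-proj₁ (u ∷ us) = cong (u ∷_) (map-proj₁ us)
        unique-pairs : (us : List (Fin n)) → Unique us → Unique (map proj₁ (map (_, i) us))
        unique-pairs us uniq = subst Unique (sym (map-proj₁ us)) uniq
        multiplicity-monochromatic : (us : List (Fin n)) → Unique us → multiplicity (assign (map (_, i) us)) i ≡ length us
        multiplicity-monochromatic us uniq =
          trans (multiplicity-assign (map (_, i) us) (unique-pairs us uniq) i)
                (trans (∑ₗ-map (_, i) us (λ x → δ (proj₂ x) i)) (trans (∑ₗ-cong us (λ _ → δ-refl i)) (sym (length≡∑ₗ us))))
        weight-monochromatic : (us : List (Fin n)) → Unique us → weight d (map (_, i) us) ≡ ff (d i) (length us)
        weight-monochromatic []       _             = refl
        weight-monochromatic (u ∷ us) (_ ∷ uniq) =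
          trans (cong₂ _*_ (cong (d i ∸_) (multiplicity-monochromatic us uniq)) (weight-monochromatic us uniq))
                (ℕₚ.*-comm (d i ∸ length us) (ff (d i) (length us)))

    ∑-two-pairs : ∀ {u v x y : Fin n} {i j : Fin s} → i ≢ j → Unique (u ∷ v ∷ x ∷ y ∷ []) →
                  ff n 4 * ∑[ f ∈ colorings c ] coloredAs f ((u , i) ∷ (v , i) ∷ (x , j) ∷ (y , j) ∷ [])
                    ≡ numColorings * (ff (d i) 2 * ff (d j) 2)
    ∑-two-pairs {u} {v} {x} {y} {i} {j} i≢j uniq@(_ ∷ uniq₁@(_ ∷ uniq₂@(_ ∷ uniq₃))) =
      trans (∑-coloredAs ((u , i) ∷ (v , i) ∷ (x , j) ∷ (y , j) ∷ []) uniq) (cong (numColorings *_) weight≡)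
      where
        δⱼᵢ : δ j i ≡ 0
        δⱼᵢ = 𝟙-no (j Fin.≟ i) (λ j≡i → i≢j (sym j≡i))
        m₁ : multiplicity (assign ((v , i) ∷ (x , j) ∷ (y , j) ∷ [])) i ≡ 1
        m₁ = trans (multiplicity-assign ((v , i) ∷ (x , j) ∷ (y , j) ∷ []) uniq₁ i) (cong₂ (λ a b → a + (b + (b + 0))) (δ-refl i) δⱼᵢ)
        m₂ : multiplicity (assign ((x , j) ∷ (y , j) ∷ [])) i ≡ 0
        m₂ = trans (multiplicity-assign ((x , j) ∷ (y , j) ∷ []) uniq₂ i) (cong (λ b → b + (b + 0)) δⱼᵢ)
        m₃ : multiplicity (assign ((y , j) ∷ [])) j ≡ 1
        m₃ = trans (multiplicity-assign ((y , j) ∷ []) uniq₃ j) (cong (_+ 0) (δ-refl j))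
        m₄ : multiplicity (assign {n = n} []) j ≡ 0
        m₄ = multiplicity-empty {n = n} j
        ff²-ff² : ∀ a a′ b b′ → a′ * (a * (b′ * (b * 1))) ≡ ((1 * a) * a′) * ((1 * b) * b′)
        ff²-ff² = solve-∀
        weight≡ : weight d ((u , i) ∷ (v , i) ∷ (x , j) ∷ (y , j) ∷ []) ≡ ff (d i) 2 * ff (d j) 2
        weight≡ rewrite m₁ | m₂ | m₃ | m₄ = ff²-ff² (d i) (d i ∸ 1) (d j) (d j ∸ 1)

  module _ {n : ℕ} where

    sameEdge oneShared disjoint sharedVertices : Fin n → Fin n → Fin n → Fin n → ℕ
    sameEdge       u v x y = δ x u * δ y v + δ x v * δ y u
    oneShared      u v x y = δ x u * (1 ∸ δ y v) + δ x v * (1 ∸ δ y u) + (1 ∸ δ x v) * δ y u + (1 ∸ δ x u) * δ y v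
    disjoint       u v x y = (1 ∸ δ x u) * (1 ∸ δ x v) * (1 ∸ δ y u) * (1 ∸ δ y v)
    sharedVertices u v x y = δ x u + δ x v + δ y u + δ y v

    overlap-classes : ∀ {u v x y : Fin n} → u ≢ v → x ≢ y →
      sameEdge u v x y + oneShared u v x y + disjoint u v x y ≡ 1 × oneShared u v x y + 2 * sameEdge u v x y ≡ sharedVertices u v x y
    overlap-classes {u} {v} {x} {y} u≢v x≢y with x Fin.≟ u | x Fin.≟ v | y Fin.≟ u | y Fin.≟ v
    ... | yes x≡u | yes x≡v | _       | _       = ⊥-elim (u≢v (trans (sym x≡u) x≡v))
    ... | _       | _       | yes y≡u | yes y≡v = ⊥-elim (u≢v (trans (sym y≡u) y≡v))
    ... | yes x≡u | _       | yes y≡u | _       = ⊥-elim (x≢y (trans x≡u (sym y≡u)))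
    ... | _       | yes x≡v | _       | yes y≡v = ⊥-elim (x≢y (trans x≡v (sym y≡v)))
    ... | yes _   | no _    | no _    | yes _   = refl , refl
    ... | no _    | yes _   | yes _   | no _    = refl , refl
    ... | yes _   | no _    | no _    | no _    = refl , refl
    ... | no _    | yes _   | no _    | no _    = refl , refl
    ... | no _    | no _    | yes _   | no _    = refl , refl
    ... | no _    | no _    | no _    | yes _   = refl , refl
    ... | no _    | no _    | no _    | no _    = refl , refl

  module _ {n : ℕ} (G : SimpleGraph n) where
    open SimpleGraph G renaming (sym to adj-sym)

    ε : Fin n → Fin n → ℕ
    ε u v = 𝟙 (T? (adj u v) ×-dec (u Fin.<? v))

    ∑-edges : (h : Fin n × Fin n → ℕ) → ∑[ e ∈ edges G ] h e ≡ ∑[ u < n ] ∑[ v < n ] (ε u v * h (u , v))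
    ∑-edges h = trans (∑ₗ-filter edge? (allPairs G) h)
      (trans (∑ₗ-concatMap (λ u → map (λ v → (u , v)) (allFin n)) (allFin n) h′)
      (trans (∑ₗ-allFin (λ u → ∑[ e ∈ map (λ v → (u , v)) (allFin n) ] h′ e))
             (sum-cong-≗ λ u → trans (∑ₗ-map (λ v → (u , v)) (allFin n) h′) (∑ₗ-allFin (λ v → h′ (u , v))))))
      where
        edge? : (e : Fin n × Fin n) → Dec (T (adj (proj₁ e) (proj₂ e)) × proj₁ e Fin.< proj₂ e)
        edge? e = T? (adj (proj₁ e) (proj₂ e)) ×-dec (proj₁ e Fin.<? proj₂ e)
        h′ : Fin n × Fin n → ℕ
        h′ e = 𝟙 (edge? e) * h e

    numEdges≡∑ε : numEdges G ≡ ∑[ u < n ] ∑[ v < n ] ε u v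
    numEdges≡∑ε = trans (length≡∑ₗ (edges G)) (trans (∑-edges (λ _ → 1)) (∑-∑-cong λ u v → ℕₚ.*-identityʳ (ε u v)))

    Mᵢ≡∑ε : ∀ {s} (i : Fin s) f → Mᵢ G i f ≡ ∑[ u < n ] ∑[ v < n ] (ε u v * (δ (f u) i * δ (f v) i))
    Mᵢ≡∑ε i f = trans (length-filter≡∑ₗ _ (edges G))
      (trans (∑ₗ-cong (edges G) (λ e → 𝟙-× (f (proj₁ e) Fin.≟ i) (f (proj₂ e) Fin.≟ i))) (∑-edges _))

    ε≡ : ∀ u v → ε u v ≡ 𝟙 (T? (adj u v)) * 𝟙 (u Fin.<? v)
    ε≡ u v = 𝟙-× (T? (adj u v)) (u Fin.<? v)

    ε-loop : ∀ u → ε u u ≡ 0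
    ε-loop u = trans (ε≡ u u) (cong (λ b → 𝟙 (T? b) * 𝟙 (u Fin.<? u)) (irrefl u))

    ε-guard : ∀ u v {X Y : ℕ} → (u ≢ v → X ≡ Y) → ε u v * X ≡ ε u v * Y
    ε-guard u v X≡Y with u Fin.≟ v
    ... | yes refl = trans (cong (_* _) (ε-loop u)) (sym (cong (_* _) (ε-loop u)))
    ... | no u≢v   = cong (ε u v *_) (X≡Y u≢v)

    ε-idem : ∀ u v → ε u v * ε u v ≡ ε u v
    ε-idem u v = 𝟙-idem _

    ε-antisym : ∀ u v → ε u v * ε v u ≡ 0
    ε-antisym u v = trans (cong₂ _*_ (ε≡ u v) (ε≡ v u)) (vanish (u Fin.<? v) (v Fin.<? u))
      where
        vanish : (d : Dec (u Fin.< v)) (e : Dec (v Fin.< u)) → (𝟙 (T? (adj u v)) * 𝟙 d) * (𝟙 (T? (adj v u)) * 𝟙 e) ≡ 0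
        vanish (yes u<v) (yes v<u) = ⊥-elim (Finₚ.<-asym u<v v<u)
        vanish (yes _)   (no _)    = trans (cong (𝟙 (T? (adj u v)) * 1 *_) (ℕₚ.*-zeroʳ (𝟙 (T? (adj v u))))) (ℕₚ.*-zeroʳ (𝟙 (T? (adj u v)) * 1))
        vanish (no _)    e         = cong (_* (𝟙 (T? (adj v u)) * 𝟙 e)) (ℕₚ.*-zeroʳ (𝟙 (T? (adj u v))))

    adjacent≡ε+ε : ∀ w v → 𝟙 (T? (adj w v)) ≡ ε w v + ε v w
    adjacent≡ε+ε w v with Finₚ.<-cmp w v | ε≡ w v | ε≡ v w
    ... | tri< w<v _ v≮w | εwv | εvw = sym (trans (cong₂ _+_ εwv εvw)
      (trans (cong₂ (λ a b → 𝟙 (T? (adj w v)) * a + 𝟙 (T? (adj v w)) * b) (𝟙-yes (w Fin.<? v) w<v) (𝟙-no (v Fin.<? w) v≮w))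
             (trans (cong₂ _+_ (ℕₚ.*-identityʳ _) (ℕₚ.*-zeroʳ (𝟙 (T? (adj v w))))) (ℕₚ.+-identityʳ _)))) 
    ... | tri≈ _ refl _ | εwv | _ = sym (trans (cong (λ k → k + k) (trans εwv (cong (λ b → 𝟙 (T? b) * 𝟙 (w Fin.<? w)) (irrefl w))))
                                             (cong (λ b → 𝟙 (T? b)) (sym (irrefl w))))
    ... | tri> w≮v _ v<w | εwv | εvw = sym (trans (cong₂ _+_ εwv εvw)
      (trans (cong₂ (λ a b → 𝟙 (T? (adj w v)) * a + 𝟙 (T? (adj v w)) * b) (𝟙-no (w Fin.<? v) w≮v) (𝟙-yes (v Fin.<? w) v<w))
             (trans (cong₂ _+_ (ℕₚ.*-zeroʳ (𝟙 (T? (adj w v)))) (ℕₚ.*-identityʳ _)) (cong (λ b → 𝟙 (T? b)) (adj-sym v w)))))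

    degree≡∑ε : ∀ w → degree G w ≡ ∑[ v < n ] (ε w v + ε v w)
    degree≡∑ε w = trans (length-filter≡∑ₗ (λ v → T? (adj w v)) (allFin n)) (trans (∑ₗ-allFin (λ v → 𝟙 (T? (adj w v)))) (sum-cong-≗ (adjacent≡ε+ε w)))

    incident : (Fin n → Fin n → Fin n → Fin n → ℕ) → Fin n → Fin n → ℕ
    incident t u v = ∑[ x < n ] ∑[ y < n ] (ε x y * t u v x y)

    pairs : (Fin n → Fin n → Fin n → Fin n → ℕ) → ℕ
    pairs t = ∑[ u < n ] ∑[ v < n ] (ε u v * incident t u v)

    pairs-cong : ∀ {t t′} → (∀ {u v x y} → u ≢ v → x ≢ y → t u v x y ≡ t′ u v x y) → pairs t ≡ pairs t′
    pairs-cong t≡t′ = ∑-∑-cong λ u v → ε-guard u v λ u≢v → ∑-∑-cong λ x y → ε-guard x y λ x≢y → t≡t′ u≢v x≢y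

    pairs-+ : ∀ t t′ → pairs (λ u v x y → t u v x y + t′ u v x y) ≡ pairs t + pairs t′
    pairs-+ t t′ = trans (∑-∑-cong λ u v → trans (cong (ε u v *_) (incident-+ u v)) (ℕₚ.*-distribˡ-+ (ε u v) (incident t u v) (incident t′ u v)))
                         (∑-∑-distrib-+ (λ u v → ε u v * incident t u v) (λ u v → ε u v * incident t′ u v))
      where
        incident-+ : ∀ u v → incident (λ u v x y → t u v x y + t′ u v x y) u v ≡ incident t u v + incident t′ u v
        incident-+ u v = trans (∑-∑-cong λ x y → ℕₚ.*-distribˡ-+ (ε x y) (t u v x y) (t′ u v x y))
                               (∑-∑-distrib-+ (λ x y → ε x y * t u v x y) (λ x y → ε x y * t′ u v x y))

    pairs-*ˡ : ∀ c t → pairs (λ u v x y → c * t u v x y) ≡ c * pairs t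
    pairs-*ˡ c t = trans (∑-∑-cong λ u v → trans (cong (ε u v *_) (incident-*ˡ u v)) (rearrange (ε u v) c (incident t u v)))
                         (∑-∑-*ˡ c (λ u v → ε u v * incident t u v))
      where
        rearrange : ∀ a b z → a * (b * z) ≡ b * (a * z)
        rearrange = solve-∀
        incident-*ˡ : ∀ u v → incident (λ u v x y → c * t u v x y) u v ≡ c * incident t u v
        incident-*ˡ u v = trans (∑-∑-cong λ x y → rearrange (ε x y) c (t u v x y)) (∑-∑-*ˡ c (λ x y → ε x y * t u v x y))

    pairs-all : pairs (λ _ _ _ _ → 1) ≡ numEdges G * numEdges G
    pairs-all = trans (∑-∑-cong λ u v → cong (ε u v *_) incident-all)
                      (trans (∑-∑-*ʳ (numEdges G) ε) (cong (_* numEdges G) (sym numEdges≡∑ε)))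
      where
        incident-all : ∑[ x < n ] ∑[ y < n ] (ε x y * 1) ≡ numEdges G
        incident-all = trans (∑-∑-cong λ x y → ℕₚ.*-identityʳ (ε x y)) (sym numEdges≡∑ε)

    ∑-ε-endpoint : ∀ w → ∑[ x < n ] ∑[ y < n ] (ε x y * (δ x w + δ y w)) ≡ degree G w
    ∑-ε-endpoint w = begin
      ∑[ x < n ] ∑[ y < n ] (ε x y * (δ x w + δ y w))
        ≡⟨ trans (∑-∑-cong λ x y → ℕₚ.*-distribˡ-+ (ε x y) (δ x w) (δ y w)) (∑-∑-distrib-+ (λ x y → ε x y * δ x w) (λ x y → ε x y * δ y w)) ⟩
      ∑[ x < n ] ∑[ y < n ] (ε x y * δ x w) + ∑[ x < n ] ∑[ y < n ] (ε x y * δ y w)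
        ≡⟨ cong₂ _+_ (trans (∑-comm (λ x y → ε x y * δ x w)) (sum-cong-≗ λ y → trans (sum-cong-≗ λ x → ℕₚ.*-comm (ε x y) (δ x w)) (∑-δ w (λ x → ε x y))))
                     (sum-cong-≗ λ x → trans (sum-cong-≗ λ y → ℕₚ.*-comm (ε x y) (δ y w)) (∑-δ w (ε x))) ⟩
      ∑[ y < n ] ε w y + ∑[ x < n ] ε x w
        ≡⟨ sym (∑-distrib-+ (ε w) (λ y → ε y w)) ⟩
      ∑[ y < n ] (ε w y + ε y w)
        ≡⟨ sym (degree≡∑ε w) ⟩
      degree G w ∎
      where open ≡-Reasoning

    pairs-sharedVertices : pairs sharedVertices ≡ Σ₂ G
    pairs-sharedVertices = begin
      ∑[ u < n ] ∑[ v < n ] (ε u v * incident sharedVertices u v)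
        ≡⟨ ∑-∑-cong (λ u v → cong (ε u v *_) (incident-shared u v)) ⟩
      ∑[ u < n ] ∑[ v < n ] (ε u v * (degree G u + degree G v))
        ≡⟨ trans (∑-∑-cong λ u v → ℕₚ.*-distribˡ-+ (ε u v) (degree G u) (degree G v))
                 (∑-∑-distrib-+ (λ u v → ε u v * degree G u) (λ u v → ε u v * degree G v)) ⟩
      ∑[ u < n ] ∑[ v < n ] (ε u v * degree G u) + ∑[ u < n ] ∑[ v < n ] (ε u v * degree G v)
        ≡⟨ cong₂ _+_ (sum-cong-≗ λ u → sym (*-distribʳ-sum (degree G u) (ε u)))
                     (trans (∑-comm (λ u v → ε u v * degree G v)) (sum-cong-≗ λ v → sym (*-distribʳ-sum (degree G v) (λ u → ε u v)))) ⟩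
      ∑[ w < n ] (∑[ y < n ] ε w y * degree G w) + ∑[ w < n ] (∑[ y < n ] ε y w * degree G w)
        ≡⟨ sym (∑-distrib-+ (λ w → ∑[ y < n ] ε w y * degree G w) (λ w → ∑[ y < n ] ε y w * degree G w)) ⟩
      ∑[ w < n ] (∑[ y < n ] ε w y * degree G w + ∑[ y < n ] ε y w * degree G w)
        ≡⟨ sum-cong-≗ (λ w → trans (sym (ℕₚ.*-distribʳ-+ (degree G w) (∑[ y < n ] ε w y) (∑[ y < n ] ε y w)))
                                   (cong (_* degree G w) (trans (sym (∑-distrib-+ (ε w) (λ y → ε y w))) (sym (degree≡∑ε w))))) ⟩
      ∑[ w < n ] (degree G w * degree G w)
        ≡⟨ sym (sumFin≡sum (λ w → degree G w * degree G w)) ⟩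
      Σ₂ G ∎
      where
        open ≡-Reasoning
        split : ∀ e a b c d → e * (a + b + c + d) ≡ e * (a + c) + e * (b + d)
        split = solve-∀
        incident-shared : ∀ u v → incident sharedVertices u v ≡ degree G u + degree G v
        incident-shared u v = trans (∑-∑-cong λ x y → split (ε x y) (δ x u) (δ x v) (δ y u) (δ y v))
          (trans (∑-∑-distrib-+ (λ x y → ε x y * (δ x u + δ y u)) (λ x y → ε x y * (δ x v + δ y v)))
                 (cong₂ _+_ (∑-ε-endpoint u) (∑-ε-endpoint v)))

    pairs-sameEdge : pairs sameEdge ≡ numEdges G
    pairs-sameEdge = begin
      ∑[ u < n ] ∑[ v < n ] (ε u v * incident sameEdge u v)
        ≡⟨ ∑-∑-cong (λ u v → cong (ε u v *_) (incident-same u v)) ⟩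
      ∑[ u < n ] ∑[ v < n ] (ε u v * (ε u v + ε v u))
        ≡⟨ ∑-∑-cong (λ u v → trans (ℕₚ.*-distribˡ-+ (ε u v) (ε u v) (ε v u))
                                   (trans (cong₂ _+_ (ε-idem u v) (ε-antisym u v)) (ℕₚ.+-identityʳ (ε u v)))) ⟩
      ∑[ u < n ] ∑[ v < n ] ε u v
        ≡⟨ sym numEdges≡∑ε ⟩
      numEdges G ∎
      where
        open ≡-Reasoning
        incident-same : ∀ u v → incident sameEdge u v ≡ ε u v + ε v u
        incident-same u v = trans (∑-∑-cong λ x y → ℕₚ.*-distribˡ-+ (ε x y) (δ x u * δ y v) (δ x v * δ y u))
          (trans (∑-∑-distrib-+ (λ x y → ε x y * (δ x u * δ y v)) (λ x y → ε x y * (δ x v * δ y u)))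
                 (cong₂ _+_ (∑-∑-δ-δ u v ε) (∑-∑-δ-δ v u ε)))

    pairs-partition : pairs sameEdge + pairs oneShared + pairs disjoint ≡ numEdges G * numEdges G
    pairs-partition = begin
      pairs sameEdge + pairs oneShared + pairs disjoint
        ≡⟨ cong (_+ pairs disjoint) (sym (pairs-+ sameEdge oneShared)) ⟩
      pairs (λ u v x y → sameEdge u v x y + oneShared u v x y) + pairs disjoint
        ≡⟨ sym (pairs-+ (λ u v x y → sameEdge u v x y + oneShared u v x y) disjoint) ⟩
      pairs (λ u v x y → sameEdge u v x y + oneShared u v x y + disjoint u v x y)
        ≡⟨ pairs-cong (λ u≢v x≢y → proj₁ (overlap-classes u≢v x≢y)) ⟩
      pairs (λ _ _ _ _ → 1)
        ≡⟨ pairs-all ⟩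
      numEdges G * numEdges G ∎
      where open ≡-Reasoning

    pairs-oneShared : pairs oneShared + 2 * pairs sameEdge ≡ Σ₂ G
    pairs-oneShared = begin
      pairs oneShared + 2 * pairs sameEdge
        ≡⟨ cong (pairs oneShared +_) (sym (pairs-*ˡ 2 sameEdge)) ⟩
      pairs oneShared + pairs (λ u v x y → 2 * sameEdge u v x y)
        ≡⟨ sym (pairs-+ oneShared (λ u v x y → 2 * sameEdge u v x y)) ⟩
      pairs (λ u v x y → oneShared u v x y + 2 * sameEdge u v x y)
        ≡⟨ pairs-cong (λ u≢v x≢y → proj₂ (overlap-classes u≢v x≢y)) ⟩
      pairs sharedVertices
        ≡⟨ pairs-sharedVertices ⟩
      Σ₂ G ∎
      where open ≡-Reasoning

    ∑ε-*-∑ε : (a b : Fin n → Fin n → ℕ) →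
              (∑[ u < n ] ∑[ v < n ] (ε u v * a u v)) * (∑[ x < n ] ∑[ y < n ] (ε x y * b x y)) ≡ pairs (λ u v x y → a u v * b x y)
    ∑ε-*-∑ε a b = trans (sym (∑-∑-*ʳ ∑b (λ u v → ε u v * a u v))) (∑-∑-cong λ u v → trans (ℕₚ.*-assoc (ε u v) (a u v) ∑b) (cong (ε u v *_) (inner u v)))
      where
        ∑b = ∑[ x < n ] ∑[ y < n ] (ε x y * b x y)
        rearrange : ∀ p q r → p * (q * r) ≡ q * (p * r)
        rearrange = solve-∀
        inner : ∀ u v → a u v * ∑b ≡ incident (λ u v x y → a u v * b x y) u v
        inner u v = trans (sym (∑-∑-*ˡ (a u v) (λ x y → ε x y * b x y))) (∑-∑-cong λ x y → rearrange (a u v) (ε x y) (b x y))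

    ∑ₗ-pairs : (xs : List A) (h : A → Fin n → Fin n → Fin n → Fin n → ℕ) →
               ∑[ z ∈ xs ] pairs (h z) ≡ pairs (λ u v x y → ∑[ z ∈ xs ] h z u v x y)
    ∑ₗ-pairs xs h = trans (∑ₗ-weighted xs ε (λ z → incident (h z)))
                          (∑-∑-cong λ u v → cong (ε u v *_) (∑ₗ-weighted xs ε (λ z x y → h z u v x y)))

  bothColored : ∀ {n s} → (Fin n → Fin s) → Fin s → Fin n → Fin n → ℕ
  bothColored f i u v = δ (f u) i * δ (f v) i

  module _ {n s : ℕ} (c : Composition n s) where

    private
      d : Fin s → ℕ
      d = Composition.part c
      N : ℕ
      N = numColorings c

    -- n↓4 times the probability that both edges uv and xy are monochromatic of color i: it depends only
    -- on how many endpoints the edges share.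
    sameColorWeight : Fin s → Fin n → Fin n → Fin n → Fin n → ℕ
    sameColorWeight i u v x y = ff (d i) 4 * disjoint u v x y + (n ∸ 3) * ff (d i) 3 * oneShared u v x y
                                + (n ∸ 2) * (n ∸ 3) * ff (d i) 2 * sameEdge u v x y

    ∑-bothColored : ∀ i {u v} → u ≢ v → ff n 2 * ∑[ f ∈ colorings c ] bothColored f i u v ≡ N * ff (d i) 2
    ∑-bothColored i {u} {v} u≢v =
      trans (cong (ff n 2 *_) (∑ₗ-cong (colorings c) λ f → cong (δ (f u) i *_) (sym (ℕₚ.*-identityʳ (δ (f v) i)))))
            (∑-monochromatic c (u ∷ v ∷ []) i ((u≢v ∷ []) ∷ [] ∷ []))

    private
      ∑-two-colored : ∀ i {u v x y a b : Fin n} → a ≢ b →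
                      (∀ f → bothColored f i u v * bothColored f i x y ≡ coloredAs f ((a , i) ∷ (b , i) ∷ [])) →
                      ff n 4 * ∑[ f ∈ colorings c ] (bothColored f i u v * bothColored f i x y) ≡ N * (ff (d i) 4 * 0 + (n ∸ 3) * ff (d i) 3 * 0 + (n ∸ 2) * (n ∸ 3) * ff (d i) 2 * 1)
      ∑-two-colored i {a = a} {b} a≢b h≡ = trans (cong (ff n 4 *_) (∑ₗ-cong (colorings c) h≡))
        (trans (scale (ff n 2) (n ∸ 2) (n ∸ 3) (∑[ f ∈ colorings c ] coloredAs f ((a , i) ∷ (b , i) ∷ [])))
        (trans (cong ((n ∸ 2) * (n ∸ 3) *_) (∑-monochromatic c (a ∷ b ∷ []) i ((a≢b ∷ []) ∷ [] ∷ [])))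
               (finish N (n ∸ 2) (n ∸ 3) (ff (d i) 2) (ff (d i) 3) (ff (d i) 4))))
        where
          scale : ∀ F A B S → F * A * B * S ≡ A * B * (F * S)
          scale = solve-∀
          finish : ∀ N A B c₂ c₃ c₄ → A * B * (N * c₂) ≡ N * (c₄ * 0 + B * c₃ * 0 + A * B * c₂ * 1)
          finish = solve-∀

      ∑-three-colored : ∀ i {u v x y a b e : Fin n} → Unique (a ∷ b ∷ e ∷ []) →
                        (∀ f → bothColored f i u v * bothColored f i x y ≡ coloredAs f ((a , i) ∷ (b , i) ∷ (e , i) ∷ [])) →
                        ff n 4 * ∑[ f ∈ colorings c ] (bothColored f i u v * bothColored f i x y) ≡ N * (ff (d i) 4 * 0 + (n ∸ 3) * ff (d i) 3 * 1 + (n ∸ 2) * (n ∸ 3) * ff (d i) 2 * 0)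
      ∑-three-colored i {a = a} {b} {e} uniq h≡ = trans (cong (ff n 4 *_) (∑ₗ-cong (colorings c) h≡))
        (trans (scale (ff n 3) (n ∸ 3) (∑[ f ∈ colorings c ] coloredAs f ((a , i) ∷ (b , i) ∷ (e , i) ∷ [])))
        (trans (cong ((n ∸ 3) *_) (∑-monochromatic c (a ∷ b ∷ e ∷ []) i uniq))
               (finish N (n ∸ 2) (n ∸ 3) (ff (d i) 2) (ff (d i) 3) (ff (d i) 4))))
        where
          scale : ∀ F B S → F * B * S ≡ B * (F * S)
          scale = solve-∀
          finish : ∀ N A B c₂ c₃ c₄ → B * (N * c₃) ≡ N * (c₄ * 0 + B * c₃ * 1 + A * B * c₂ * 0)
          finish = solve-∀

      ∑-four-colored : ∀ i {u v x y : Fin n} → Unique (u ∷ v ∷ x ∷ y ∷ []) →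
                       (∀ f → bothColored f i u v * bothColored f i x y ≡ coloredAs f ((u , i) ∷ (v , i) ∷ (x , i) ∷ (y , i) ∷ [])) →
                       ff n 4 * ∑[ f ∈ colorings c ] (bothColored f i u v * bothColored f i x y) ≡ N * (ff (d i) 4 * 1 + (n ∸ 3) * ff (d i) 3 * 0 + (n ∸ 2) * (n ∸ 3) * ff (d i) 2 * 0)
      ∑-four-colored i {u} {v} {x} {y} uniq h≡ = trans (cong (ff n 4 *_) (∑ₗ-cong (colorings c) h≡))
        (trans (∑-monochromatic c (u ∷ v ∷ x ∷ y ∷ []) i uniq) (finish N (n ∸ 2) (n ∸ 3) (ff (d i) 2) (ff (d i) 3) (ff (d i) 4)))
        where
          finish : ∀ N A B c₂ c₃ c₄ → N * c₄ ≡ N * (c₄ * 1 + B * c₃ * 0 + A * B * c₂ * 0)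
          finish = solve-∀

      unique₃ : ∀ {a b e : Fin n} → a ≢ b → a ≢ e → b ≢ e → Unique (a ∷ b ∷ e ∷ [])
      unique₃ a≢b a≢e b≢e = (a≢b ∷ a≢e ∷ []) ∷ (b≢e ∷ []) ∷ [] ∷ []

      unique₄ : ∀ {a b e g : Fin n} → a ≢ b → a ≢ e → a ≢ g → b ≢ e → b ≢ g → e ≢ g → Unique (a ∷ b ∷ e ∷ g ∷ [])
      unique₄ a≢b a≢e a≢g b≢e b≢g e≢g = (a≢b ∷ a≢e ∷ a≢g ∷ []) ∷ (b≢e ∷ b≢g ∷ []) ∷ (e≢g ∷ []) ∷ [] ∷ []

      squash : ∀ (A : ℕ) {P R} → P ≡ (A * A) * R → A * A ≡ A → P ≡ A * R
      squash A {R = R} P≡ AA = trans P≡ (cong (_* R) AA)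

      squash₂ : ∀ (A B : ℕ) {P} → P ≡ (A * A) * ((B * B) * 1) → A * A ≡ A → B * B ≡ B → P ≡ A * (B * 1)
      squash₂ A B P≡ AA BB = trans P≡ (cong₂ (λ a b → a * (b * 1)) AA BB)

      same-edge : ∀ A B → (A * B) * (A * B) ≡ (A * A) * ((B * B) * 1)
      same-edge = solve-∀

      shared : ∀ A B C → (A * B) * (A * C) ≡ (A * A) * (B * (C * 1))
      shared = solve-∀

      disjoint-edges : ∀ A B C D → (A * B) * (C * D) ≡ A * (B * (C * (D * 1)))
      disjoint-edges = solve-∀

    ∑-four-monochromatic : ∀ i {u v x y} → u ≢ v → x ≢ y →
      ff n 4 * ∑[ f ∈ colorings c ] (bothColored f i u v * bothColored f i x y) ≡ N * sameColorWeight i u v x y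
    ∑-four-monochromatic i {u} {v} {x} {y} u≢v x≢y with x Fin.≟ u | x Fin.≟ v | y Fin.≟ u | y Fin.≟ v
    ... | yes x≡u  | yes x≡v  | _        | _        = ⊥-elim (u≢v (trans (sym x≡u) x≡v))
    ... | _        | _        | yes y≡u  | yes y≡v  = ⊥-elim (u≢v (trans (sym y≡u) y≡v))
    ... | yes x≡u  | _        | yes y≡u  | _        = ⊥-elim (x≢y (trans x≡u (sym y≡u)))
    ... | _        | yes x≡v  | _        | yes y≡v  = ⊥-elim (x≢y (trans x≡v (sym y≡v)))
    ... | yes refl | no _     | no _     | yes refl = ∑-two-colored i u≢v λ f →
      squash₂ (δ (f u) i) (δ (f v) i) (same-edge (δ (f u) i) (δ (f v) i)) (𝟙-idem (f u Fin.≟ i)) (𝟙-idem (f v Fin.≟ i))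
    ... | no _     | yes refl | yes refl | no _     = ∑-two-colored i u≢v λ f →
      squash₂ (δ (f u) i) (δ (f v) i) (trans (cong (bothColored f i u v *_) (ℕₚ.*-comm (δ (f v) i) (δ (f u) i))) (same-edge (δ (f u) i) (δ (f v) i)))
              (𝟙-idem (f u Fin.≟ i)) (𝟙-idem (f v Fin.≟ i))
    ... | yes refl | no _     | no y≢u   | no y≢v   = ∑-three-colored i (unique₃ u≢v (≢-sym y≢u) (≢-sym y≢v)) λ f →
      squash (δ (f u) i) (shared (δ (f u) i) (δ (f v) i) (δ (f y) i)) (𝟙-idem (f u Fin.≟ i))
    ... | no x≢u   | yes refl | no y≢u   | no y≢v   = ∑-three-colored i (unique₃ (≢-sym u≢v) (≢-sym y≢v) (≢-sym y≢u)) λ f →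
      squash (δ (f v) i) (trans (cong (_* bothColored f i v y) (ℕₚ.*-comm (δ (f u) i) (δ (f v) i))) (shared (δ (f v) i) (δ (f u) i) (δ (f y) i)))
             (𝟙-idem (f v Fin.≟ i))
    ... | no x≢u   | no x≢v   | yes refl | no _     = ∑-three-colored i (unique₃ u≢v (≢-sym x≢u) (≢-sym x≢v)) λ f →
      squash (δ (f u) i) (trans (cong (bothColored f i u v *_) (ℕₚ.*-comm (δ (f x) i) (δ (f u) i))) (shared (δ (f u) i) (δ (f v) i) (δ (f x) i)))
             (𝟙-idem (f u Fin.≟ i))
    ... | no x≢u   | no x≢v   | no _     | yes refl = ∑-three-colored i (unique₃ (≢-sym u≢v) (≢-sym x≢v) (≢-sym x≢u)) λ f →
      squash (δ (f v) i) (trans (cong₂ _*_ (ℕₚ.*-comm (δ (f u) i) (δ (f v) i)) (ℕₚ.*-comm (δ (f x) i) (δ (f v) i)))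
                                (shared (δ (f v) i) (δ (f u) i) (δ (f x) i)))
             (𝟙-idem (f v Fin.≟ i))
    ... | no x≢u   | no x≢v   | no y≢u   | no y≢v   =
      ∑-four-colored i (unique₄ u≢v (≢-sym x≢u) (≢-sym y≢u) (≢-sym x≢v) (≢-sym y≢v) x≢y) λ f →
        disjoint-edges (δ (f u) i) (δ (f v) i) (δ (f x) i) (δ (f y) i)

    private
      clash : ∀ {i j : Fin s} → i ≢ j → ∀ a → δ a i * δ a j ≡ 0
      clash {i} {j} i≢j a with a Fin.≟ i
      ... | yes refl = trans (ℕₚ.+-identityʳ (δ a j)) (𝟙-no (a Fin.≟ j) i≢j)
      ... | no _     = refl

      vanishes : ∀ {i j u v x y} K → (∀ f → bothColored f i u v * bothColored f j x y ≡ 0) →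
                 ff n 4 * ∑[ f ∈ colorings c ] (bothColored f i u v * bothColored f j x y) ≡ N * (K * 0)
      vanishes K h≡0 = trans (cong (ff n 4 *_) (trans (∑ₗ-cong (colorings c) h≡0) (∑ₗ-const (colorings c) 0)))
                             (trans (cong (ff n 4 *_) (ℕₚ.*-zeroʳ N)) (trans (ℕₚ.*-zeroʳ (ff n 4)) (sym (trans (cong (N *_) (ℕₚ.*-zeroʳ K)) (ℕₚ.*-zeroʳ N)))))

      regroup₁ : ∀ a b e g → (a * b) * (e * g) ≡ (a * e) * (b * g)
      regroup₁ = solve-∀
      regroup₂ : ∀ a b e g → (a * b) * (e * g) ≡ (b * e) * (a * g)
      regroup₂ = solve-∀
      regroup₃ : ∀ a b e g → (a * b) * (e * g) ≡ (a * g) * (b * e)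
      regroup₃ = solve-∀
      regroup₄ : ∀ a b e g → (a * b) * (e * g) ≡ (b * g) * (a * e)
      regroup₄ = solve-∀

    ∑-four-dichromatic : ∀ {i j} → i ≢ j → ∀ {u v x y} → u ≢ v → x ≢ y →
      ff n 4 * ∑[ f ∈ colorings c ] (bothColored f i u v * bothColored f j x y) ≡ N * (ff (d i) 2 * ff (d j) 2 * disjoint u v x y)
    ∑-four-dichromatic {i} {j} i≢j {u} {v} {x} {y} u≢v x≢y with x Fin.≟ u | x Fin.≟ v | y Fin.≟ u | y Fin.≟ v
    ... | yes refl | _        | _        | _        = vanishes (ff (d i) 2 * ff (d j) 2) λ f →
      trans (regroup₁ (δ (f u) i) (δ (f v) i) (δ (f u) j) (δ (f y) j)) (cong (_* (δ (f v) i * δ (f y) j)) (clash i≢j (f u)))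
    ... | no _     | yes refl | _        | _        = vanishes (ff (d i) 2 * ff (d j) 2) λ f →
      trans (regroup₂ (δ (f u) i) (δ (f v) i) (δ (f v) j) (δ (f y) j)) (cong (_* (δ (f u) i * δ (f y) j)) (clash i≢j (f v)))
    ... | no _     | no _     | yes refl | _        = vanishes (ff (d i) 2 * ff (d j) 2) λ f →
      trans (regroup₃ (δ (f u) i) (δ (f v) i) (δ (f x) j) (δ (f u) j)) (cong (_* (δ (f v) i * δ (f x) j)) (clash i≢j (f u)))
    ... | no _     | no _     | no _     | yes refl = vanishes (ff (d i) 2 * ff (d j) 2) λ f →
      trans (regroup₄ (δ (f u) i) (δ (f v) i) (δ (f x) j) (δ (f v) j)) (cong (_* (δ (f u) i * δ (f x) j)) (clash i≢j (f v)))
    ... | no x≢u   | no x≢v   | no y≢u   | no y≢v   =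
      trans (cong (ff n 4 *_) (∑ₗ-cong (colorings c) λ f → disjoint-edges (δ (f u) i) (δ (f v) i) (δ (f x) j) (δ (f y) j)))
            (trans (∑-two-pairs c i≢j (unique₄ u≢v (≢-sym x≢u) (≢-sym y≢u) (≢-sym x≢v) (≢-sym y≢v) x≢y))
                   (cong (N *_) (sym (ℕₚ.*-identityʳ _))))

  module _ {n s : ℕ} (G : SimpleGraph n) (c : Composition n s) where

    private
      d : Fin s → ℕ
      d = Composition.part c
      N : ℕ
      N = numColorings c

    ∑-Mᵢ : ∀ i → ff n 2 * ∑[ f ∈ colorings c ] Mᵢ G i f ≡ N * (numEdges G * ff (d i) 2)
    ∑-Mᵢ i = begin
      ff n 2 * ∑[ f ∈ colorings c ] Mᵢ G i f
        ≡⟨ cong (ff n 2 *_) (trans (∑ₗ-cong (colorings c) (Mᵢ≡∑ε G i)) (∑ₗ-weighted (colorings c) (ε G) (λ f → bothColored f i))) ⟩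
      ff n 2 * ∑[ u < n ] ∑[ v < n ] (ε G u v * ∑[ f ∈ colorings c ] bothColored f i u v)
        ≡⟨ ∑-∑-weighted-*ˡ (ff n 2) (ε G) (λ u v → ∑[ f ∈ colorings c ] bothColored f i u v) ⟩
      ∑[ u < n ] ∑[ v < n ] (ε G u v * (ff n 2 * ∑[ f ∈ colorings c ] bothColored f i u v))
        ≡⟨ ∑-∑-cong (λ u v → ε-guard G u v (∑-bothColored c i)) ⟩
      ∑[ u < n ] ∑[ v < n ] (ε G u v * (N * ff (d i) 2))
        ≡⟨ ∑-∑-*ʳ (N * ff (d i) 2) (ε G) ⟩
      (∑[ u < n ] ∑[ v < n ] ε G u v) * (N * ff (d i) 2)
        ≡⟨ cong (_* (N * ff (d i) 2)) (sym (numEdges≡∑ε G)) ⟩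
      numEdges G * (N * ff (d i) 2)
        ≡⟨ rearrange (numEdges G) N (ff (d i) 2) ⟩
      N * (numEdges G * ff (d i) 2) ∎
      where
        open ≡-Reasoning
        rearrange : ∀ x y z → x * (y * z) ≡ y * (x * z)
        rearrange = solve-∀

    ∑-Mᵢ*Mⱼ : ∀ i j (R : Fin n → Fin n → Fin n → Fin n → ℕ) →
      (∀ {u v x y} → u ≢ v → x ≢ y → ff n 4 * ∑[ f ∈ colorings c ] (bothColored f i u v * bothColored f j x y) ≡ N * R u v x y) →
      ff n 4 * ∑[ f ∈ colorings c ] (Mᵢ G i f * Mᵢ G j f) ≡ N * pairs G R
    ∑-Mᵢ*Mⱼ i j R ∑≡ = begin
      ff n 4 * ∑[ f ∈ colorings c ] (Mᵢ G i f * Mᵢ G j f)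
        ≡⟨ cong (ff n 4 *_) (∑ₗ-cong (colorings c) λ f → trans (cong₂ _*_ (Mᵢ≡∑ε G i f) (Mᵢ≡∑ε G j f))
                                                              (∑ε-*-∑ε G (bothColored f i) (bothColored f j))) ⟩
      ff n 4 * ∑[ f ∈ colorings c ] pairs G (λ u v x y → bothColored f i u v * bothColored f j x y)
        ≡⟨ cong (ff n 4 *_) (∑ₗ-pairs G (colorings c) (λ f u v x y → bothColored f i u v * bothColored f j x y)) ⟩
      ff n 4 * pairs G (λ u v x y → ∑[ f ∈ colorings c ] (bothColored f i u v * bothColored f j x y))
        ≡⟨ sym (pairs-*ˡ G (ff n 4) (λ u v x y → ∑[ f ∈ colorings c ] (bothColored f i u v * bothColored f j x y))) ⟩
      pairs G (λ u v x y → ff n 4 * ∑[ f ∈ colorings c ] (bothColored f i u v * bothColored f j x y))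
        ≡⟨ pairs-cong G ∑≡ ⟩
      pairs G (λ u v x y → N * R u v x y)
        ≡⟨ pairs-*ˡ G N R ⟩
      N * pairs G R ∎
      where open ≡-Reasoning

    sameColorMoment : Fin s → ℕ
    sameColorMoment i = ff (d i) 4 * pairs G disjoint + (n ∸ 3) * ff (d i) 3 * pairs G oneShared
                        + (n ∸ 2) * (n ∸ 3) * ff (d i) 2 * pairs G sameEdge

    pairs-sameColorWeight : ∀ i → pairs G (sameColorWeight c i) ≡ sameColorMoment i
    pairs-sameColorWeight i =
      trans (pairs-+ G (λ u v x y → c₄ * disjoint u v x y + c₃ * oneShared u v x y) (λ u v x y → c₂ * sameEdge u v x y))
            (cong₂ _+_ (trans (pairs-+ G (λ u v x y → c₄ * disjoint u v x y) (λ u v x y → c₃ * oneShared u v x y))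
                              (cong₂ _+_ (pairs-*ˡ G c₄ disjoint) (pairs-*ˡ G c₃ oneShared)))
                       (pairs-*ˡ G c₂ sameEdge))
      where
        c₄ = ff (d i) 4
        c₃ = (n ∸ 3) * ff (d i) 3
        c₂ = (n ∸ 2) * (n ∸ 3) * ff (d i) 2

    ∑-Mᵢ² : ∀ i → ff n 4 * ∑[ f ∈ colorings c ] (Mᵢ G i f * Mᵢ G i f) ≡ N * sameColorMoment i
    ∑-Mᵢ² i = trans (∑-Mᵢ*Mⱼ i i (sameColorWeight c i) (∑-four-monochromatic c i)) (cong (N *_) (pairs-sameColorWeight i))

    ∑-Mᵢ*Mⱼ-distinct : ∀ {i j} → i ≢ j → ff n 4 * ∑[ f ∈ colorings c ] (Mᵢ G i f * Mᵢ G j f) ≡ N * (ff (d i) 2 * ff (d j) 2 * pairs G disjoint)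
    ∑-Mᵢ*Mⱼ-distinct {i} {j} i≢j =
      trans (∑-Mᵢ*Mⱼ i j (λ u v x y → ff (d i) 2 * ff (d j) 2 * disjoint u v x y) (∑-four-dichromatic c i≢j))
            (cong (N *_) (pairs-*ˡ G (ff (d i) 2 * ff (d j) 2) disjoint))

    ∑-M : ff n 2 * ∑[ f ∈ colorings c ] M G f ≡ N * (numEdges G * ∑[ i < s ] ff (d i) 2)
    ∑-M = begin
      ff n 2 * ∑[ f ∈ colorings c ] M G f
        ≡⟨ cong (ff n 2 *_) (trans (∑ₗ-cong (colorings c) (λ f → sumFin≡sum (λ i → Mᵢ G i f))) (∑ₗ-∑-comm (colorings c) (λ f i → Mᵢ G i f))) ⟩
      ff n 2 * ∑[ i < s ] ∑[ f ∈ colorings c ] Mᵢ G i f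
        ≡⟨ *-distribˡ-sum (ff n 2) (λ i → ∑[ f ∈ colorings c ] Mᵢ G i f) ⟩
      ∑[ i < s ] (ff n 2 * ∑[ f ∈ colorings c ] Mᵢ G i f)
        ≡⟨ sum-cong-≗ ∑-Mᵢ ⟩
      ∑[ i < s ] (N * (numEdges G * ff (d i) 2))
        ≡⟨ sym (trans (cong (N *_) (*-distribˡ-sum (numEdges G) (λ i → ff (d i) 2))) (*-distribˡ-sum N (λ i → numEdges G * ff (d i) 2))) ⟩
      N * (numEdges G * ∑[ i < s ] ff (d i) 2) ∎
      where open ≡-Reasoning

    ∑-Mᵢ*Mⱼ-by-colors : ∀ i j → ff n 4 * ∑[ f ∈ colorings c ] (Mᵢ G i f * Mᵢ G j f)
                                    ≡ N * (δ i j * sameColorMoment i + (1 ∸ δ i j) * (ff (d i) 2 * ff (d j) 2 * pairs G disjoint))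
    ∑-Mᵢ*Mⱼ-by-colors i j with i Fin.≟ j
    ... | yes refl = trans (∑-Mᵢ² i) (cong (N *_) (sym (trans (ℕₚ.+-identityʳ (1 * sameColorMoment i)) (ℕₚ.*-identityˡ (sameColorMoment i)))))
    ... | no i≢j   = trans (∑-Mᵢ*Mⱼ-distinct i≢j) (cong (N *_) (sym (ℕₚ.+-identityʳ (ff (d i) 2 * ff (d j) 2 * pairs G disjoint))))

    ∑-sameColorMoment : ∑[ i < s ] sameColorMoment i ≡ ∑[ i < s ] ff (d i) 4 * pairs G disjoint + (n ∸ 3) * ∑[ i < s ] ff (d i) 3 * pairs G oneShared
                                                       + (n ∸ 2) * (n ∸ 3) * ∑[ i < s ] ff (d i) 2 * pairs G sameEdge
    ∑-sameColorMoment = begin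
      ∑[ i < s ] sameColorMoment i
        ≡⟨ trans (∑-distrib-+ (λ i → ff (d i) 4 * D + (n ∸ 3) * ff (d i) 3 * O) (λ i → (n ∸ 2) * (n ∸ 3) * ff (d i) 2 * S))
                 (cong (_+ ∑[ i < s ] ((n ∸ 2) * (n ∸ 3) * ff (d i) 2 * S)) (∑-distrib-+ (λ i → ff (d i) 4 * D) (λ i → (n ∸ 3) * ff (d i) 3 * O))) ⟩
      ∑[ i < s ] (ff (d i) 4 * D) + ∑[ i < s ] ((n ∸ 3) * ff (d i) 3 * O) + ∑[ i < s ] ((n ∸ 2) * (n ∸ 3) * ff (d i) 2 * S)
        ≡⟨ cong₂ _+_ (cong₂ _+_ (∑-*ʳ D (λ i → ff (d i) 4)) (∑-k*-*ʳ (n ∸ 3) O (λ i → ff (d i) 3))) (∑-k*-*ʳ ((n ∸ 2) * (n ∸ 3)) S (λ i → ff (d i) 2)) ⟩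
      ∑[ i < s ] ff (d i) 4 * D + (n ∸ 3) * ∑[ i < s ] ff (d i) 3 * O + (n ∸ 2) * (n ∸ 3) * ∑[ i < s ] ff (d i) 2 * S ∎
      where
        open ≡-Reasoning
        D = pairs G disjoint
        O = pairs G oneShared
        S = pairs G sameEdge
        ∑-*ʳ : ∀ z (g : Fin s → ℕ) → ∑[ i < s ] (g i * z) ≡ sum g * z
        ∑-*ʳ z g = sym (*-distribʳ-sum z g)
        ∑-k*-*ʳ : ∀ k z (g : Fin s → ℕ) → ∑[ i < s ] (k * g i * z) ≡ k * sum g * z
        ∑-k*-*ʳ k z g = trans (∑-*ʳ z (λ i → k * g i)) (cong (_* z) (sym (*-distribˡ-sum k g)))

    ∑-M² : ff n 4 * ∑[ f ∈ colorings c ] (M G f * M G f) ≡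
      N * ((∑[ i < s ] ff (d i) 4 + ∑[ i < s ] ∑[ j < s ] ((1 ∸ δ i j) * (ff (d i) 2 * ff (d j) 2))) * pairs G disjoint
           + (n ∸ 3) * ∑[ i < s ] ff (d i) 3 * pairs G oneShared + (n ∸ 2) * (n ∸ 3) * ∑[ i < s ] ff (d i) 2 * pairs G sameEdge)
    ∑-M² = begin
      ff n 4 * ∑[ f ∈ colorings c ] (M G f * M G f)
        ≡⟨ cong (ff n 4 *_) (trans (∑ₗ-cong (colorings c) λ f → trans (cong₂ _*_ (sumFin≡sum (λ i → Mᵢ G i f)) (sumFin≡sum (λ i → Mᵢ G i f)))
                                                                      (sum-*-sum (λ i → Mᵢ G i f) (λ j → Mᵢ G j f)))
                                   (∑ₗ-∑-∑-comm (colorings c) (λ f i j → Mᵢ G i f * Mᵢ G j f))) ⟩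
      ff n 4 * ∑[ i < s ] ∑[ j < s ] ∑[ f ∈ colorings c ] (Mᵢ G i f * Mᵢ G j f)
        ≡⟨ sym (∑-∑-*ˡ (ff n 4) (λ i j → ∑[ f ∈ colorings c ] (Mᵢ G i f * Mᵢ G j f))) ⟩
      ∑[ i < s ] ∑[ j < s ] (ff n 4 * ∑[ f ∈ colorings c ] (Mᵢ G i f * Mᵢ G j f))
        ≡⟨ ∑-∑-cong ∑-Mᵢ*Mⱼ-by-colors ⟩
      ∑[ i < s ] ∑[ j < s ] (N * (δ i j * sameColorMoment i + (1 ∸ δ i j) * (c₂ i * c₂ j * D)))
        ≡⟨ ∑-∑-*ˡ N (λ i j → δ i j * sameColorMoment i + (1 ∸ δ i j) * (c₂ i * c₂ j * D)) ⟩
      N * ∑[ i < s ] ∑[ j < s ] (δ i j * sameColorMoment i + (1 ∸ δ i j) * (c₂ i * c₂ j * D))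
        ≡⟨ cong (N *_) (trans (∑-∑-distrib-+ (λ i j → δ i j * sameColorMoment i) (λ i j → (1 ∸ δ i j) * (c₂ i * c₂ j * D)))
                              (cong₂ _+_ (sum-cong-≗ λ i → ∑-δ′ i (λ _ → sameColorMoment i))
                                         (trans (∑-∑-cong λ i j → sym (ℕₚ.*-assoc (1 ∸ δ i j) (c₂ i * c₂ j) D))
                                                (∑-∑-*ʳ D (λ i j → (1 ∸ δ i j) * (c₂ i * c₂ j)))))) ⟩
      N * (∑[ i < s ] sameColorMoment i + X * D)
        ≡⟨ cong (λ k → N * (k + X * D)) ∑-sameColorMoment ⟩
      N * (P₄ * D + (n ∸ 3) * P₃ * O + (n ∸ 2) * (n ∸ 3) * P₂ * S + X * D)
        ≡⟨ cong (N *_) (regroup (P₄ * D) ((n ∸ 3) * P₃ * O) ((n ∸ 2) * (n ∸ 3) * P₂ * S) X P₄ D) ⟩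
      N * ((P₄ + X) * D + (n ∸ 3) * P₃ * O + (n ∸ 2) * (n ∸ 3) * P₂ * S) ∎
      where
        open ≡-Reasoning
        c₂ : Fin s → ℕ
        c₂ i = ff (d i) 2
        D = pairs G disjoint
        O = pairs G oneShared
        S = pairs G sameEdge
        P₂ = ∑[ i < s ] ff (d i) 2
        P₃ = ∑[ i < s ] ff (d i) 3
        P₄ = ∑[ i < s ] ff (d i) 4
        X = ∑[ i < s ] ∑[ j < s ] ((1 ∸ δ i j) * (c₂ i * c₂ j))
        regroup : ∀ a b e x p₄ z → p₄ * z + b + e + x * z ≡ (p₄ + x) * z + b + e
        regroup = solve-∀

    M≤numEdges : ∀ f → M G f ≤ numEdges G
    M≤numEdges f = subst₂ _≤_ (sym M≡) (sym (numEdges≡∑ε G))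
      (∑-mono-≤ λ u → ∑-mono-≤ λ v → subst (ε G u v * δ (f v) (f u) ≤_) (ℕₚ.*-identityʳ (ε G u v))
                                            (ℕₚ.*-monoʳ-≤ (ε G u v) (𝟙≤1 (f v Fin.≟ f u))))
      where
        M≡ : M G f ≡ ∑[ u < n ] ∑[ v < n ] (ε G u v * δ (f v) (f u))
        M≡ = begin
          M G f
            ≡⟨ trans (sumFin≡sum (λ i → Mᵢ G i f)) (sum-cong-≗ (λ i → Mᵢ≡∑ε G i f)) ⟩
          ∑[ i < s ] ∑[ u < n ] ∑[ v < n ] (ε G u v * bothColored f i u v)
            ≡⟨ trans (∑-comm (λ i u → ∑[ v < n ] (ε G u v * bothColored f i u v))) (sum-cong-≗ λ u → ∑-comm (λ i v → ε G u v * bothColored f i u v)) ⟩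
          ∑[ u < n ] ∑[ v < n ] ∑[ i < s ] (ε G u v * bothColored f i u v)
            ≡⟨ ∑-∑-cong (λ u v → trans (sym (*-distribˡ-sum (ε G u v) (λ i → bothColored f i u v))) (cong (ε G u v *_) (∑-δ′ (f u) (λ i → δ (f v) i)))) ⟩
          ∑[ u < n ] ∑[ v < n ] (ε G u v * δ (f v) (f u)) ∎
          where open ≡-Reasoning

  ff-zero : ∀ x k → x < k → ff x k ≡ 0
  ff-zero x (suc k) x<1+k with ℕₚ.m≤n⇒m<n∨m≡n (ℕₚ.≤-pred x<1+k)
  ... | inj₁ x<k  = cong (_* (x ∸ k)) (ff-zero x k x<k)
  ... | inj₂ refl = trans (cong (ff x x *_) (ℕₚ.n∸n≡0 x)) (ℕₚ.*-zeroʳ (ff x x))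

  ff-*-∸ : ∀ {c n} k → c ≤ n → ff c k * (n ∸ k) ≡ ff c k * (n ∸ c) + ff c (suc k)
  ff-*-∸ {c} {n} k c≤n with k ≤? c
  ... | yes k≤c = trans (cong (ff c k *_) n∸k≡) (ℕₚ.*-distribˡ-+ (ff c k) (n ∸ c) (c ∸ k))
    where
      n∸k≡ : n ∸ k ≡ (n ∸ c) + (c ∸ k)
      n∸k≡ = sym (trans (sym (ℕₚ.+-∸-assoc (n ∸ c) k≤c)) (cong (_∸ k) (ℕₚ.m∸n+n≡m c≤n)))
  ... | no k≰c = trans (cong (_* (n ∸ k)) ffₖ≡0) (sym (trans (cong (λ z → z * (n ∸ c) + z * (c ∸ k)) ffₖ≡0) refl))
    where
      ffₖ≡0 : ff c k ≡ 0
      ffₖ≡0 = ff-zero c k (ℕₚ.≰⇒> k≰c)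

  ff-2 : ∀ x → ff x 2 + x ≡ x * x
  ff-2 zero    = refl
  ff-2 (suc y) = expand y
    where
      expand : ∀ y → (1 * suc y) * y + suc y ≡ suc y * suc y
      expand = solve-∀

  ff-3 : ∀ x → ff x 3 + 3 * ff x 2 + x ≡ x * x * x
  ff-3 zero          = refl
  ff-3 (suc zero)    = refl
  ff-3 (suc (suc y)) = expand y
    where
      expand : ∀ y → (1 * suc (suc y)) * suc y * y + 3 * ((1 * suc (suc y)) * suc y) + suc (suc y) ≡ suc (suc y) * suc (suc y) * suc (suc y)
      expand = solve-∀

  ff-2² : ∀ x → ff x 4 + 4 * ff x 3 + 2 * ff x 2 ≡ ff x 2 * ff x 2
  ff-2² zero                = refl
  ff-2² (suc zero)          = refl
  ff-2² (suc (suc zero))    = refl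
  ff-2² (suc (suc (suc y))) = expand y
    where
      expand : ∀ y → (1 * suc (suc (suc y))) * suc (suc y) * suc y * y + 4 * ((1 * suc (suc (suc y))) * suc (suc y) * suc y)
                     + 2 * ((1 * suc (suc (suc y))) * suc (suc y))
                   ≡ ((1 * suc (suc (suc y))) * suc (suc y)) * ((1 * suc (suc (suc y))) * suc (suc y))
      expand = solve-∀

  esym-1 : ∀ {s} (c : Fin s → ℕ) → esym 1 (tabulate c) ≡ sum c
  esym-1 {zero}  c = refl
  esym-1 {suc s} c = cong₂ _+_ (ℕₚ.*-identityʳ (c zero)) (esym-1 (λ i → c (suc i)))

  ∑ff-2 : ∀ {s} (c : Fin s → ℕ) → ∑[ i < s ] ff (c i) 2 + sum c + 2 * esym 2 (tabulate c) ≡ sum c * sum c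
  ∑ff-2 {zero}  c = refl
  ∑ff-2 {suc s} c = begin
      (ff x 2 + P′) + (x + S′) + 2 * (x * esym 1 (tabulate c′) + E′)
        ≡⟨ cong (λ z → (ff x 2 + P′) + (x + S′) + 2 * (x * z + E′)) (esym-1 c′) ⟩
      (ff x 2 + P′) + (x + S′) + 2 * (x * S′ + E′)
        ≡⟨ regroup (ff x 2) P′ x S′ E′ ⟩
      (ff x 2 + x) + (P′ + S′ + 2 * E′) + 2 * (x * S′)
        ≡⟨ cong₂ (λ z w → z + w + 2 * (x * S′)) (ff-2 x) (∑ff-2 c′) ⟩
      x * x + S′ * S′ + 2 * (x * S′)
        ≡⟨ square x S′ ⟩
      (x + S′) * (x + S′) ∎
    where
      open ≡-Reasoning
      x = c zero
      c′ : Fin s → ℕ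
      c′ i = c (suc i)
      P′ = ∑[ i < s ] ff (c′ i) 2
      S′ = sum c′
      E′ = esym 2 (tabulate c′)
      regroup : ∀ F P x S E → (F + P) + (x + S) + 2 * (x * S + E) ≡ (F + x) + (P + S + 2 * E) + 2 * (x * S)
      regroup = solve-∀
      square : ∀ x S → x * x + S * S + 2 * (x * S) ≡ (x + S) * (x + S)
      square = solve-∀

  ∑ff-3 : ∀ {s} (c : Fin s → ℕ) →
          ∑[ i < s ] ff (c i) 3 + 3 * ∑[ i < s ] ff (c i) 2 + sum c + 3 * (sum c * esym 2 (tabulate c))
            ≡ sum c * sum c * sum c + 3 * esym 3 (tabulate c)
  ∑ff-3 {zero}  c = refl
  ∑ff-3 {suc s} c = begin
      (ff x 3 + P₃′) + 3 * (ff x 2 + P₂′) + (x + S′) + 3 * ((x + S′) * (x * esym 1 (tabulate c′) + E₂′))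
        ≡⟨ cong (λ z → (ff x 3 + P₃′) + 3 * (ff x 2 + P₂′) + (x + S′) + 3 * ((x + S′) * (x * z + E₂′))) (esym-1 c′) ⟩
      (ff x 3 + P₃′) + 3 * (ff x 2 + P₂′) + (x + S′) + 3 * ((x + S′) * (x * S′ + E₂′))
        ≡⟨ regroup (ff x 3) P₃′ (ff x 2) P₂′ x S′ E₂′ ⟩
      (ff x 3 + 3 * ff x 2 + x) + (P₃′ + 3 * P₂′ + S′ + 3 * (S′ * E₂′)) + 3 * (x * x * S′) + 3 * (x * S′ * S′) + 3 * (x * E₂′)
        ≡⟨ cong₂ (λ z w → z + w + 3 * (x * x * S′) + 3 * (x * S′ * S′) + 3 * (x * E₂′)) (ff-3 x) (∑ff-3 c′) ⟩
      x * x * x + (S′ * S′ * S′ + 3 * E₃′) + 3 * (x * x * S′) + 3 * (x * S′ * S′) + 3 * (x * E₂′)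
        ≡⟨ cube x S′ E₂′ E₃′ ⟩
      (x + S′) * (x + S′) * (x + S′) + 3 * (x * E₂′ + E₃′) ∎
    where
      open ≡-Reasoning
      x = c zero
      c′ : Fin s → ℕ
      c′ i = c (suc i)
      P₂′ = ∑[ i < s ] ff (c′ i) 2
      P₃′ = ∑[ i < s ] ff (c′ i) 3
      S′ = sum c′
      E₂′ = esym 2 (tabulate c′)
      E₃′ = esym 3 (tabulate c′)
      regroup : ∀ F₃ P₃ F₂ P₂ x S E → (F₃ + P₃) + 3 * (F₂ + P₂) + (x + S) + 3 * ((x + S) * (x * S + E))
                                     ≡ (F₃ + 3 * F₂ + x) + (P₃ + 3 * P₂ + S + 3 * (S * E)) + 3 * (x * x * S) + 3 * (x * S * S) + 3 * (x * E)
      regroup = solve-∀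
      cube : ∀ x S E₂ E₃ → x * x * x + (S * S * S + 3 * E₃) + 3 * (x * x * S) + 3 * (x * S * S) + 3 * (x * E₂)
                           ≡ (x + S) * (x + S) * (x + S) + 3 * (x * E₂ + E₃)
      cube = solve-∀

  ∑ff-2² : ∀ {s} (c : Fin s → ℕ) →
           ∑[ i < s ] ff (c i) 4 + ∑[ i < s ] ∑[ j < s ] ((1 ∸ δ i j) * (ff (c i) 2 * ff (c j) 2))
             + 4 * ∑[ i < s ] ff (c i) 3 + 2 * ∑[ i < s ] ff (c i) 2
           ≡ ∑[ i < s ] ff (c i) 2 * ∑[ i < s ] ff (c i) 2
  ∑ff-2² {s} c = sym (begin
      P₂ * P₂
        ≡⟨ sum-*-sum c₂ c₂ ⟩
      ∑[ i < s ] ∑[ j < s ] (c₂ i * c₂ j)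
        ≡⟨ ∑-∑-cong (λ i j → trans (sym (ℕₚ.*-identityˡ (c₂ i * c₂ j)))
                                   (trans (cong (_* (c₂ i * c₂ j)) (sym (ℕₚ.m+[n∸m]≡n (𝟙≤1 (i Fin.≟ j)))))
                                          (ℕₚ.*-distribʳ-+ (c₂ i * c₂ j) (δ i j) (1 ∸ δ i j)))) ⟩
      ∑[ i < s ] ∑[ j < s ] (δ i j * (c₂ i * c₂ j) + (1 ∸ δ i j) * (c₂ i * c₂ j))
        ≡⟨ ∑-∑-distrib-+ (λ i j → δ i j * (c₂ i * c₂ j)) (λ i j → (1 ∸ δ i j) * (c₂ i * c₂ j)) ⟩
      ∑[ i < s ] ∑[ j < s ] (δ i j * (c₂ i * c₂ j)) + X
        ≡⟨ cong (_+ X) (sum-cong-≗ λ i → ∑-δ′ i (λ j → c₂ i * c₂ j)) ⟩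
      ∑[ i < s ] (c₂ i * c₂ i) + X
        ≡⟨ cong (_+ X) (sum-cong-≗ λ i → sym (ff-2² (c i))) ⟩
      ∑[ i < s ] (ff (c i) 4 + 4 * ff (c i) 3 + 2 * ff (c i) 2) + X
        ≡⟨ cong (_+ X) (trans (∑-distrib-+ (λ i → ff (c i) 4 + 4 * ff (c i) 3) (λ i → 2 * ff (c i) 2))
                        (cong₂ _+_ (trans (∑-distrib-+ (λ i → ff (c i) 4) (λ i → 4 * ff (c i) 3))
                                          (cong (P₄ +_) (sym (*-distribˡ-sum 4 (λ i → ff (c i) 3)))))
                                   (sym (*-distribˡ-sum 2 c₂)))) ⟩
      P₄ + 4 * P₃ + 2 * P₂ + X
        ≡⟨ regroup P₄ P₃ P₂ X ⟩
      P₄ + X + 4 * P₃ + 2 * P₂ ∎)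
    where
      open ≡-Reasoning
      c₂ : Fin s → ℕ
      c₂ i = ff (c i) 2
      P₂ = sum c₂
      P₃ = ∑[ i < s ] ff (c i) 3
      P₄ = ∑[ i < s ] ff (c i) 4
      X = ∑[ i < s ] ∑[ j < s ] ((1 ∸ δ i j) * (c₂ i * c₂ j))
      regroup : ∀ A B C D → A + 4 * B + 2 * C + D ≡ A + D + 4 * B + 2 * C
      regroup = solve-∀

  ff-pos : ∀ {n} k → k ≤ n → 1 ≤ ff n k
  ff-pos zero    _   = ℕₚ.≤-refl
  ff-pos (suc k) k<n = ℕₚ.*-mono-≤ (ff-pos k (ℕₚ.<⇒≤ k<n)) (ℕₚ.m<n⇒0<n∸m k<n)

  ∑ff-2+2esym₂ : ∀ {s n} (c : Fin s → ℕ) → sum c ≡ n → ∑[ i < s ] ff (c i) 2 + 2 * esym 2 (tabulate c) ≡ ff n 2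
  ∑ff-2+2esym₂ {s} {n} c ∑c≡n = ℕₚ.+-cancelʳ-≡ n _ _ (begin
    ∑[ i < s ] ff (c i) 2 + 2 * esym 2 (tabulate c) + n   ≡⟨ swap (∑[ i < s ] ff (c i) 2) (2 * esym 2 (tabulate c)) n ⟩
    ∑[ i < s ] ff (c i) 2 + n + 2 * esym 2 (tabulate c)   ≡⟨ subst (λ k → ∑[ i < s ] ff (c i) 2 + k + 2 * esym 2 (tabulate c) ≡ k * k) ∑c≡n (∑ff-2 c) ⟩
    n * n                                                 ≡⟨ sym (ff-2 n) ⟩
    ff n 2 + n                                            ∎)
    where
      open ≡-Reasoning
      swap : ∀ a b e → a + b + e ≡ a + e + b
      swap = solve-∀

open Counting
open import Data.Rational as ℚ using (ℚ; mkℚ; 0ℚ; 1ℚ; _+_; _-_; _*_)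
import Data.Rational.Properties as ℚₚ
open import Data.Integer as ℤ using (ℤ)
import Data.Integer.Properties as ℤₚ
open import Data.Nat.Coprimality using (1-coprimeTo) renaming (sym to coprime-sym)
open import Data.Maybe using (Maybe; just; nothing)
open import Data.Empty using (⊥-elim)
open import Relation.Nullary using (yes; no)
open import Tactic.RingSolver using (solve-∀)
import Tactic.RingSolver.Core.AlmostCommutativeRing as ACR

ℚ-ring : ACR.AlmostCommutativeRing _ _
ℚ-ring = ACR.fromCommutativeRing ℚₚ.+-*-commutativeRing is-zero?
  where
    is-zero? : ∀ x → Maybe (0ℚ ≡ x)
    is-zero? x with 0ℚ ℚₚ.≟ x
    ... | yes 0≡x = just 0≡x
    ... | no _    = nothing

⟦⟧≡mkℚ : ∀ k → ⟦ k ⟧ ≡ mkℚ (ℤ.+ k) 0 (coprime-sym (1-coprimeTo k))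
⟦⟧≡mkℚ k = ℚₚ.normalize-coprime (coprime-sym (1-coprimeTo k))

⟦⟧-+ : ∀ j k → ⟦ j ℕ.+ k ⟧ ≡ ⟦ j ⟧ + ⟦ k ⟧
⟦⟧-+ j k = sym (trans (cong₂ _+_ (⟦⟧≡mkℚ j) (⟦⟧≡mkℚ k))
                      (ℚₚ./-cong (trans (cong₂ ℤ._+_ (ℤₚ.*-identityʳ (ℤ.+ j)) (ℤₚ.*-identityʳ (ℤ.+ k))) (sym (ℤₚ.pos-+ j k))) refl))

⟦⟧-* : ∀ j k → ⟦ j ℕ.* k ⟧ ≡ ⟦ j ⟧ * ⟦ k ⟧
⟦⟧-* j k = sym (trans (cong₂ _*_ (⟦⟧≡mkℚ j) (⟦⟧≡mkℚ k)) (ℚₚ./-cong (sym (ℤₚ.pos-* j k)) refl))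

⟦⟧-∸ : ∀ {j k} → k ≤ j → ⟦ j ℕ.∸ k ⟧ ≡ ⟦ j ⟧ - ⟦ k ⟧
⟦⟧-∸ {j} {k} k≤j = trans (sym (cancel ⟦ j ℕ.∸ k ⟧ ⟦ k ⟧))
                         (cong (_- ⟦ k ⟧) (trans (sym (⟦⟧-+ (j ℕ.∸ k) k)) (cong ⟦_⟧ (ℕₚ.m∸n+n≡m k≤j))))
  where
    cancel : ∀ x y → (x + y) - y ≡ x
    cancel = solve-∀ ℚ-ring

⟦⟧≢0 : ∀ {k} → 1 ≤ k → ⟦ k ⟧ ≢ 0ℚ
⟦⟧≢0 {suc k} _ ⟦k⟧≡0 with cong ℚ.numerator (trans (sym (⟦⟧≡mkℚ (suc k))) ⟦k⟧≡0)
... | ()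

-- inv 0ℚ = 0ℚ, which makes ÷₀≡*inv hold without a side condition.
inv : ℚ → ℚ
inv q = 1ℚ ÷₀ q

÷₀≡*inv : ∀ p q → p ÷₀ q ≡ p * inv q
÷₀≡*inv p q with q ℚ.≟ 0ℚ
... | yes _ = sym (ℚₚ.*-zeroʳ p)
... | no _  = cong (p *_) (sym (ℚₚ.*-identityˡ _))

*-inv : ∀ {q} → q ≢ 0ℚ → q * inv q ≡ 1ℚ
*-inv {q} q≢0 with q ℚ.≟ 0ℚ
... | yes q≡0 = ⊥-elim (q≢0 q≡0)
... | no q≢0′ = trans (cong (q *_) (ℚₚ.*-identityˡ _)) (ℚₚ.*-inverseʳ q {{ℚ.≢-nonZero q≢0′}})

inv-factor : ∀ {p q} r → q ≢ 0ℚ → q ≡ p * r → inv p ≡ r * inv q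
inv-factor {p} {q} r q≢0 q≡pr = begin
  inv p                       ≡⟨ sym (trans (cong (inv p *_) (*-inv q≢0)) (ℚₚ.*-identityʳ (inv p))) ⟩
  inv p * (q * inv q)         ≡⟨ cong (λ x → inv p * (x * inv q)) q≡pr ⟩
  inv p * ((p * r) * inv q)   ≡⟨ regroup (inv p) p r (inv q) ⟩
  (p * inv p) * (r * inv q)   ≡⟨ trans (cong (_* (r * inv q)) (*-inv p≢0)) (ℚₚ.*-identityˡ _) ⟩
  r * inv q                   ∎
  where
    open ≡-Reasoning
    regroup : ∀ x y z w → x * ((y * z) * w) ≡ (y * x) * (z * w)
    regroup = solve-∀ ℚ-ring
    p≢0 : p ≢ 0ℚ
    p≢0 p≡0 = q≢0 (trans q≡pr (trans (cong (_* r) p≡0) (ℚₚ.*-zeroˡ r)))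

∑ℚ : List A → (A → ℚ) → ℚ
∑ℚ xs X = List.foldr _+_ 0ℚ (map X xs)

∑ℚ-cong : (xs : List A) {X Y : A → ℚ} → (∀ x → X x ≡ Y x) → ∑ℚ xs X ≡ ∑ℚ xs Y
∑ℚ-cong []       X≗Y = refl
∑ℚ-cong (x ∷ xs) X≗Y = cong₂ _+_ (X≗Y x) (∑ℚ-cong xs X≗Y)

∑ℚ-⟦⟧ : (xs : List A) (g : A → ℕ) → ∑ℚ xs (λ x → ⟦ g x ⟧) ≡ ⟦ ∑[ x ∈ xs ] g x ⟧
∑ℚ-⟦⟧ []       g = refl
∑ℚ-⟦⟧ (x ∷ xs) g = trans (cong (⟦ g x ⟧ +_) (∑ℚ-⟦⟧ xs g)) (sym (⟦⟧-+ (g x) _))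

∑ℚ-const-sub : (xs : List A) (a : ℚ) (X : A → ℚ) → ∑ℚ xs (λ x → a - X x) ≡ ⟦ length xs ⟧ * a - ∑ℚ xs X
∑ℚ-const-sub []       a X = sym (trans (cong (_- 0ℚ) (ℚₚ.*-zeroˡ a)) refl)
∑ℚ-const-sub (x ∷ xs) a X = trans (cong ((a - X x) +_) (∑ℚ-const-sub xs a X))
  (trans (step a (X x) ⟦ length xs ⟧ (∑ℚ xs X)) (cong (λ k → k * a - (X x + ∑ℚ xs X)) (sym (⟦⟧-+ 1 (length xs)))))
  where
    step : ∀ a y l S → (a - y) + (l * a - S) ≡ (1ℚ + l) * a - (y + S)
    step = solve-∀ ℚ-ring

∑ℚ-squared-deviation : (xs : List A) (X : A → ℚ) (μ : ℚ) →
  ∑ℚ xs (λ x → (X x - μ) * (X x - μ)) ≡ ∑ℚ xs (λ x → X x * X x) - (1ℚ + 1ℚ) * μ * ∑ℚ xs X + ⟦ length xs ⟧ * (μ * μ)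
∑ℚ-squared-deviation []       X μ = base μ
  where
    base : ∀ μ → 0ℚ ≡ 0ℚ - (1ℚ + 1ℚ) * μ * 0ℚ + 0ℚ * (μ * μ)
    base = solve-∀ ℚ-ring
∑ℚ-squared-deviation (x ∷ xs) X μ = trans (cong ((X x - μ) * (X x - μ) +_) (∑ℚ-squared-deviation xs X μ))
  (trans (step (X x) μ (∑ℚ xs (λ x → X x * X x)) (∑ℚ xs X) ⟦ length xs ⟧)
         (cong (λ k → (X x * X x + ∑ℚ xs (λ x → X x * X x)) - (1ℚ + 1ℚ) * μ * (X x + ∑ℚ xs X) + k * (μ * μ)) (sym (⟦⟧-+ 1 (length xs)))))
  where
    step : ∀ y μ Q S l → (y - μ) * (y - μ) + (Q - (1ℚ + 1ℚ) * μ * S + l * (μ * μ))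
                       ≡ (y * y + Q) - (1ℚ + 1ℚ) * μ * (y + S) + (1ℚ + l) * (μ * μ)
    step = solve-∀ ℚ-ring

module _ {n s : ℕ} (c : Composition n s) where

  private
    N : ℚ
    N = ⟦ numColorings c ⟧
    N*inv : N * inv N ≡ 1ℚ
    N*inv = *-inv (⟦⟧≢0 (numColorings-pos c))

  mean≡ : (X : (Fin n → Fin s) → ℚ) → mean c X ≡ ∑ℚ (colorings c) X * inv N
  mean≡ X = ÷₀≡*inv _ N

  mean-cong : {X Y : (Fin n → Fin s) → ℚ} → (∀ f → X f ≡ Y f) → mean c X ≡ mean c Y
  mean-cong X≗Y = cong (_÷₀ N) (∑ℚ-cong (colorings c) X≗Y)

  variance≡ : (X : (Fin n → Fin s) → ℚ) → variance c X ≡ mean c (λ f → X f * X f) - mean c X * mean c X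
  variance≡ X = begin
    mean c (λ f → (X f - μ) * (X f - μ))
      ≡⟨ mean≡ (λ f → (X f - μ) * (X f - μ)) ⟩
    ∑ℚ (colorings c) (λ f → (X f - μ) * (X f - μ)) * inv N
      ≡⟨ cong (_* inv N) (∑ℚ-squared-deviation (colorings c) X μ) ⟩
    (∑ℚ (colorings c) (λ f → X f * X f) - (1ℚ + 1ℚ) * μ * ∑ℚ (colorings c) X + N * (μ * μ)) * inv N
      ≡⟨ distribute (∑ℚ (colorings c) (λ f → X f * X f)) μ (∑ℚ (colorings c) X) N (inv N) ⟩
    ∑ℚ (colorings c) (λ f → X f * X f) * inv N - (1ℚ + 1ℚ) * μ * (∑ℚ (colorings c) X * inv N) + (N * inv N) * (μ * μ)
      ≡⟨ cong₂ (λ x y → ∑ℚ (colorings c) (λ f → X f * X f) * inv N - (1ℚ + 1ℚ) * μ * x + y * (μ * μ)) (sym (mean≡ X)) N*inv ⟩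
    ∑ℚ (colorings c) (λ f → X f * X f) * inv N - (1ℚ + 1ℚ) * μ * μ + 1ℚ * (μ * μ)
      ≡⟨ collect (∑ℚ (colorings c) (λ f → X f * X f) * inv N) μ ⟩
    ∑ℚ (colorings c) (λ f → X f * X f) * inv N - μ * μ
      ≡⟨ cong (_- μ * μ) (sym (mean≡ (λ f → X f * X f))) ⟩
    mean c (λ f → X f * X f) - μ * μ ∎
    where
      open ≡-Reasoning
      μ = mean c X
      distribute : ∀ Q μ S N i → (Q - (1ℚ + 1ℚ) * μ * S + N * (μ * μ)) * i ≡ Q * i - (1ℚ + 1ℚ) * μ * (S * i) + (N * i) * (μ * μ)
      distribute = solve-∀ ℚ-ring
      collect : ∀ E μ → E - (1ℚ + 1ℚ) * μ * μ + 1ℚ * (μ * μ) ≡ E - μ * μ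
      collect = solve-∀ ℚ-ring

  mean-const-sub : ∀ a (X : (Fin n → Fin s) → ℚ) → mean c (λ f → a - X f) ≡ a - mean c X
  mean-const-sub a X = begin
    mean c (λ f → a - X f)                             ≡⟨ mean≡ (λ f → a - X f) ⟩
    ∑ℚ (colorings c) (λ f → a - X f) * inv N           ≡⟨ cong (_* inv N) (∑ℚ-const-sub (colorings c) a X) ⟩
    (N * a - ∑ℚ (colorings c) X) * inv N               ≡⟨ distribute N a (∑ℚ (colorings c) X) (inv N) ⟩
    (N * inv N) * a - ∑ℚ (colorings c) X * inv N       ≡⟨ cong₂ (λ x y → x * a - y) N*inv (sym (mean≡ X)) ⟩
    1ℚ * a - mean c X                                  ≡⟨ cong (_- mean c X) (ℚₚ.*-identityˡ a) ⟩
    a - mean c X                                       ∎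
    where
      open ≡-Reasoning
      distribute : ∀ N a S i → (N * a - S) * i ≡ (N * i) * a - S * i
      distribute = solve-∀ ℚ-ring

  variance-const-sub : ∀ a (X : (Fin n → Fin s) → ℚ) → variance c (λ f → a - X f) ≡ variance c X
  variance-const-sub a X = mean-cong λ f →
    trans (cong (λ μ′ → (a - X f - μ′) * (a - X f - μ′)) (mean-const-sub a X)) (reflect a (X f) (mean c X))
    where
      reflect : ∀ a x μ → (a - x - (a - μ)) * (a - x - (a - μ)) ≡ (x - μ) * (x - μ)
      reflect = solve-∀ ℚ-ring

  mean-from-count : (g : (Fin n → Fin s) → ℕ) (k r : ℕ) → 1 ≤ k →
                    k ℕ.* ∑[ f ∈ colorings c ] g f ≡ numColorings c ℕ.* r → mean c (λ f → ⟦ g f ⟧) ≡ ⟦ r ⟧ * inv ⟦ k ⟧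
  mean-from-count g k r 1≤k k∑≡Nr = begin
    mean c (λ f → ⟦ g f ⟧)                      ≡⟨ trans (mean≡ (λ f → ⟦ g f ⟧)) (cong (_* inv N) (∑ℚ-⟦⟧ (colorings c) g)) ⟩
    total * inv N                                   ≡⟨ sym (trans (cong ((total * inv N) *_) (*-inv (⟦⟧≢0 1≤k))) (ℚₚ.*-identityʳ _)) ⟩
    (total * inv N) * (⟦ k ⟧ * inv ⟦ k ⟧)           ≡⟨ regroup total (inv N) ⟦ k ⟧ (inv ⟦ k ⟧) ⟩
    (⟦ k ⟧ * total) * inv N * inv ⟦ k ⟧             ≡⟨ cong (λ x → x * inv N * inv ⟦ k ⟧) cast ⟩
    (N * ⟦ r ⟧) * inv N * inv ⟦ k ⟧             ≡⟨ regroup′ N ⟦ r ⟧ (inv N) (inv ⟦ k ⟧) ⟩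
    (N * inv N) * (⟦ r ⟧ * inv ⟦ k ⟧)           ≡⟨ trans (cong (_* (⟦ r ⟧ * inv ⟦ k ⟧)) N*inv) (ℚₚ.*-identityˡ _) ⟩
    ⟦ r ⟧ * inv ⟦ k ⟧                           ∎
    where
      open ≡-Reasoning
      total = ⟦ ∑[ f ∈ colorings c ] g f ⟧
      cast : ⟦ k ⟧ * total ≡ N * ⟦ r ⟧
      cast = trans (sym (⟦⟧-* k _)) (trans (cong ⟦_⟧ k∑≡Nr) (⟦⟧-* (numColorings c) r))
      regroup : ∀ S i K j → (S * i) * (K * j) ≡ (K * S) * i * j
      regroup = solve-∀ ℚ-ring
      regroup′ : ∀ N R i j → (N * R) * i * j ≡ (N * i) * (R * j)
      regroup′ = solve-∀ ℚ-ring

  variance-cong : {X Y : (Fin n → Fin s) → ℚ} → (∀ f → X f ≡ Y f) → variance c X ≡ variance c Y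
  variance-cong X≗Y = mean-cong λ f → cong₂ (λ x μ → (x - μ) * (x - μ)) (X≗Y f) (mean-cong X≗Y)

⟦⟧-+-solve : ∀ a b {k} → a ℕ.+ b ≡ k → ⟦ a ⟧ ≡ ⟦ k ⟧ - ⟦ b ⟧
⟦⟧-+-solve a b a+b≡k = trans (sym (cancel ⟦ a ⟧ ⟦ b ⟧)) (cong (_- ⟦ b ⟧) (trans (sym (⟦⟧-+ a b)) (cong ⟦_⟧ a+b≡k)))
  where
    cancel : ∀ x y → (x + y) - y ≡ x
    cancel = solve-∀ ℚ-ring

two three four : ℚ
two   = 1ℚ + 1ℚ
three = 1ℚ + 1ℚ + 1ℚ
four  = 1ℚ + 1ℚ + 1ℚ + 1ℚ

-- Numerals are converted explicitly: leaving ⟦ k ⟧ ≡ 1ℚ + ⋯ + 1ℚ to the conversion checker inside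
-- large terms makes type checking very slow.
⟦1⟧ : 1ℚ ≡ ⟦ 1 ⟧
⟦1⟧ = refl

⟦2⟧ : two ≡ ⟦ 2 ⟧
⟦2⟧ = refl

⟦3⟧ : three ≡ ⟦ 3 ⟧
⟦3⟧ = refl

⟦4⟧ : four ≡ ⟦ 4 ⟧
⟦4⟧ = refl

variance-by-overlap : ∀ m S x₂ x₃ x₄ →
  x₄ * (m * m - S + m) + x₃ * (S - two * m) + x₂ * m - (m * x₂) * (m * x₂)
    ≡ (x₃ - x₄) * S - (x₂ * x₂ - x₄) * (m * m) + (x₂ - two * x₃ + x₄) * m
variance-by-overlap = solve-∀ ℚ-ring

σ²-form : (ν m S e₂ e₃ i₂ i₃ i₄ : ℚ) → ℚ
σ²-form ν m S e₂ e₃ i₂ i₃ i₄ = (a - b) * S + m * m * (b - four * ((e₂ * i₂) * (e₂ * i₂))) + m * ((two * e₂) * i₂ - two * a + b)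
  where
    a = e₂ * i₂ + (three * e₃) * i₃
    b = (four * i₄) * (e₂ * e₂ - (ν - 1ℚ) * e₂ - three * e₃)

-- Without the last hypothesis the two sides differ exactly by m * m * (ν↓4 * i₄ - 1ℚ),
-- where ν↓4 = ν * (ν - 1ℚ) * (ν - two) * (ν - three).
variance-by-symmetric-functions : ∀ {ν m S e₂ e₃ i₂ i₃ i₄ P₂ P₃ P₂₂} →
  i₂ ≡ (ν - two) * (ν - three) * i₄ → i₃ ≡ (ν - three) * i₄ →
  P₂ ≡ ν * (ν - 1ℚ) - two * e₂ → P₃ ≡ ν * ν * ν + three * e₃ - three * P₂ - ν - three * (ν * e₂) →
  P₂₂ ≡ P₂ * P₂ - four * P₃ - two * P₂ → ν * (ν - 1ℚ) * (ν - two) * (ν - three) * i₄ ≡ 1ℚ →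
  (P₂₂ * i₄) * (m * m - S + m) + (P₃ * i₃) * (S - two * m) + (P₂ * i₂) * m
    - (m * (1ℚ - two * (e₂ * i₂))) * (m * (1ℚ - two * (e₂ * i₂)))
  ≡ σ²-form ν m S e₂ e₃ i₂ i₃ i₄
variance-by-symmetric-functions {ν} {m} {S} {e₂} {e₃} {i₄ = i₄} refl refl refl refl refl q₄i₄≡1 =
  trans (identity ν m S e₂ e₃ i₄) (trans (cong (λ t → σ²-form′ + m * m * (t - 1ℚ)) q₄i₄≡1) (vanish σ²-form′ m))
  where
    σ²-form′ = σ²-form ν m S e₂ e₃ ((ν - two) * (ν - three) * i₄) ((ν - three) * i₄) i₄
    vanish : ∀ x m → x + m * m * (1ℚ - 1ℚ) ≡ x
    vanish = solve-∀ ℚ-ring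
    identity : ∀ ν m S e₂ e₃ i₄ →
      let i₂ = (ν - two) * (ν - three) * i₄
          i₃ = (ν - three) * i₄
          P₂ = ν * (ν - 1ℚ) - two * e₂
          P₃ = ν * ν * ν + three * e₃ - three * P₂ - ν - three * (ν * e₂)
          P₂₂ = P₂ * P₂ - four * P₃ - two * P₂
          a = e₂ * i₂ + (three * e₃) * i₃
          b = (four * i₄) * (e₂ * e₂ - (ν - 1ℚ) * e₂ - three * e₃)
      in (P₂₂ * i₄) * (m * m - S + m) + (P₃ * i₃) * (S - two * m) + (P₂ * i₂) * m
           - (m * (1ℚ - two * (e₂ * i₂))) * (m * (1ℚ - two * (e₂ * i₂)))
         ≡ (a - b) * S + m * m * (b - four * ((e₂ * i₂) * (e₂ * i₂))) + m * ((two * e₂) * i₂ - two * a + b)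
           + m * m * (ν * (ν - 1ℚ) * (ν - two) * (ν - three) * i₄ - 1ℚ)
    identity = solve-∀ ℚ-ring

module _ {n s : ℕ} (G : SimpleGraph n) (c : Composition n s) (4≤n : 4 ≤ n) where

  private
    d : Fin s → ℕ
    d = Composition.part c
    ν m S e₂ e₃ i₂ i₃ i₄ : ℚ
    ν = ⟦ n ⟧
    m = ⟦ numEdges G ⟧
    S = ⟦ Σ₂ G ⟧
    e₂ = ⟦ esym 2 (toList d) ⟧
    e₃ = ⟦ esym 3 (toList d) ⟧
    q : ℕ → ℚ
    q k = ⟦ ff n k ⟧
    i₂ = inv (q 2)
    i₃ = inv (q 3)
    i₄ = inv (q 4)

    ff-n-pos : ∀ k → k ≤ 4 → 1 ≤ ff n k
    ff-n-pos k k≤4 = ff-pos k (ℕₚ.≤-trans k≤4 4≤n)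

    q*inv : ∀ k → k ≤ 4 → q k * inv (q k) ≡ 1ℚ
    q*inv k k≤4 = *-inv (⟦⟧≢0 (ff-n-pos k k≤4))

    i₃≡ : i₃ ≡ ⟦ n ∸ 3 ⟧ * i₄
    i₃≡ = inv-factor {q 3} {q 4} ⟦ n ∸ 3 ⟧ (⟦⟧≢0 (ff-n-pos 4 ℕₚ.≤-refl)) (⟦⟧-* (ff n 3) (n ∸ 3))

    i₂≡ : i₂ ≡ ⟦ (n ∸ 2) ℕ.* (n ∸ 3) ⟧ * i₄
    i₂≡ = inv-factor {q 2} {q 4} ⟦ (n ∸ 2) ℕ.* (n ∸ 3) ⟧ (⟦⟧≢0 (ff-n-pos 4 ℕₚ.≤-refl))
                     (trans (cong ⟦_⟧ (ℕₚ.*-assoc (ff n 2) (n ∸ 2) (n ∸ 3))) (⟦⟧-* (ff n 2) _))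

    ⟦sameEdge⟧ : ⟦ pairs G sameEdge ⟧ ≡ m
    ⟦sameEdge⟧ = cong ⟦_⟧ (pairs-sameEdge G)

    ⟦oneShared⟧ : ⟦ pairs G oneShared ⟧ ≡ S - two * m
    ⟦oneShared⟧ = trans (⟦⟧-+-solve (pairs G oneShared) (2 ℕ.* pairs G sameEdge) (pairs-oneShared G)) (cong (S -_) (trans (⟦⟧-* 2 (pairs G sameEdge)) (cong (two *_) ⟦sameEdge⟧)))

    ⟦disjoint⟧ : ⟦ pairs G disjoint ⟧ ≡ m * m - S + m
    ⟦disjoint⟧ = trans (⟦⟧-+-solve (pairs G disjoint) (pairs G sameEdge ℕ.+ pairs G oneShared)
                                   (trans (ℕₚ.+-comm (pairs G disjoint) _) (pairs-partition G)))
                       (trans (cong₂ _-_ (⟦⟧-* (numEdges G) (numEdges G)) (trans (⟦⟧-+ (pairs G sameEdge) _) (cong₂ _+_ ⟦sameEdge⟧ ⟦oneShared⟧)))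
                              (simplify m S))
      where
        simplify : ∀ m S → m * m - (m + (S - two * m)) ≡ m * m - S + m
        simplify = solve-∀ ℚ-ring

    second-moment : ∀ a b e →
      ⟦ a ℕ.* pairs G disjoint ℕ.+ (n ∸ 3) ℕ.* b ℕ.* pairs G oneShared ℕ.+ (n ∸ 2) ℕ.* (n ∸ 3) ℕ.* e ℕ.* pairs G sameEdge ⟧ * i₄
        ≡ (⟦ a ⟧ * i₄) * (m * m - S + m) + (⟦ b ⟧ * i₃) * (S - two * m) + (⟦ e ⟧ * i₂) * m
    second-moment a b e = begin
      ⟦ a ℕ.* D ℕ.+ (n ∸ 3) ℕ.* b ℕ.* O ℕ.+ (n ∸ 2) ℕ.* (n ∸ 3) ℕ.* e ℕ.* Sm ⟧ * i₄
        ≡⟨ cong (_* i₄) (trans (⟦⟧-+ (a ℕ.* D ℕ.+ (n ∸ 3) ℕ.* b ℕ.* O) _) (cong₂ _+_ (⟦⟧-+ (a ℕ.* D) _) refl)) ⟩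
      (⟦ a ℕ.* D ⟧ + ⟦ (n ∸ 3) ℕ.* b ℕ.* O ⟧ + ⟦ (n ∸ 2) ℕ.* (n ∸ 3) ℕ.* e ℕ.* Sm ⟧) * i₄
        ≡⟨ cong (_* i₄) (cong₂ _+_ (cong₂ _+_ (⟦⟧-* a D) (trans (⟦⟧-* ((n ∸ 3) ℕ.* b) O) (cong (_* ⟦ O ⟧) (⟦⟧-* (n ∸ 3) b))))
                                  (trans (⟦⟧-* ((n ∸ 2) ℕ.* (n ∸ 3) ℕ.* e) Sm) (cong (_* ⟦ Sm ⟧) (⟦⟧-* ((n ∸ 2) ℕ.* (n ∸ 3)) e)))) ⟩
      (⟦ a ⟧ * ⟦ D ⟧ + (⟦ n ∸ 3 ⟧ * ⟦ b ⟧) * ⟦ O ⟧ + (⟦ (n ∸ 2) ℕ.* (n ∸ 3) ⟧ * ⟦ e ⟧) * ⟦ Sm ⟧) * i₄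
        ≡⟨ distribute ⟦ a ⟧ ⟦ D ⟧ ⟦ n ∸ 3 ⟧ ⟦ b ⟧ ⟦ O ⟧ ⟦ (n ∸ 2) ℕ.* (n ∸ 3) ⟧ ⟦ e ⟧ ⟦ Sm ⟧ i₄ ⟩
      (⟦ a ⟧ * i₄) * ⟦ D ⟧ + (⟦ b ⟧ * (⟦ n ∸ 3 ⟧ * i₄)) * ⟦ O ⟧ + (⟦ e ⟧ * (⟦ (n ∸ 2) ℕ.* (n ∸ 3) ⟧ * i₄)) * ⟦ Sm ⟧
        ≡⟨ cong₂ _+_ (cong₂ _+_ (cong ((⟦ a ⟧ * i₄) *_) ⟦disjoint⟧) (cong₂ (λ x y → (⟦ b ⟧ * x) * y) (sym i₃≡) ⟦oneShared⟧))
                     (cong₂ (λ x y → (⟦ e ⟧ * x) * y) (sym i₂≡) ⟦sameEdge⟧) ⟩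
      (⟦ a ⟧ * i₄) * (m * m - S + m) + (⟦ b ⟧ * i₃) * (S - two * m) + (⟦ e ⟧ * i₂) * m ∎
      where
        open ≡-Reasoning
        D = pairs G disjoint
        O = pairs G oneShared
        Sm = pairs G sameEdge
        distribute : ∀ a D n₃ b O n₂₃ e Sm i → (a * D + (n₃ * b) * O + (n₂₃ * e) * Sm) * i ≡ (a * i) * D + (b * (n₃ * i)) * O + (e * (n₂₃ * i)) * Sm
        distribute = solve-∀ ℚ-ring

    part≤n : ∀ i → d i ≤ n
    part≤n i = subst (d i ≤_) (trans (sym (sumFin≡sum d)) (Composition.sums c)) (term≤∑ d i)

    mean-Mᵢ-inv : ∀ i → mean c (λ f → ⟦ Mᵢ G i f ⟧) ≡ m * (⟦ ff (d i) 2 ⟧ * i₂)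
    mean-Mᵢ-inv i = trans (mean-from-count c (Mᵢ G i) (ff n 2) (numEdges G ℕ.* ff (d i) 2) (ff-n-pos 2 (s≤s (s≤s z≤n))) (∑-Mᵢ G c i))
                    (trans (cong (_* i₂) (⟦⟧-* (numEdges G) (ff (d i) 2))) (ℚₚ.*-assoc m ⟦ ff (d i) 2 ⟧ i₂))

  mean-Mᵢ : ∀ i → mean c (λ f → ⟦ Mᵢ G i f ⟧) ≡ m * (⟦ ff (d i) 2 ⟧ ÷₀ q 2)
  mean-Mᵢ i = trans (mean-Mᵢ-inv i) (cong (m *_) (sym (÷₀≡*inv ⟦ ff (d i) 2 ⟧ (q 2))))

  mean-Mᵢ² : ∀ i → mean c (λ f → ⟦ Mᵢ G i f ⟧ * ⟦ Mᵢ G i f ⟧)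
                   ≡ (⟦ ff (d i) 4 ⟧ * i₄) * (m * m - S + m) + (⟦ ff (d i) 3 ⟧ * i₃) * (S - two * m) + (⟦ ff (d i) 2 ⟧ * i₂) * m
  mean-Mᵢ² i = trans (mean-cong c λ f → sym (⟦⟧-* (Mᵢ G i f) (Mᵢ G i f)))
    (trans (mean-from-count c (λ f → Mᵢ G i f ℕ.* Mᵢ G i f) (ff n 4) _ (ff-n-pos 4 ℕₚ.≤-refl) (∑-Mᵢ² G c i))
           (second-moment (ff (d i) 4) (ff (d i) 3) (ff (d i) 2)))

  ⟦ff₃*[n∸cᵢ]⟧ : ∀ i → ⟦ ff (d i) 3 ℕ.* (n ∸ d i) ⟧ * i₄ ≡ ⟦ ff (d i) 3 ⟧ * i₃ - ⟦ ff (d i) 4 ⟧ * i₄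
  ⟦ff₃*[n∸cᵢ]⟧ i = begin
    ⟦ ff (d i) 3 ℕ.* (n ∸ d i) ⟧ * i₄
      ≡⟨ cong (_* i₄) (⟦⟧-+-solve (ff (d i) 3 ℕ.* (n ∸ d i)) (ff (d i) 4) (sym (ff-*-∸ 3 (part≤n i)))) ⟩
    (⟦ ff (d i) 3 ℕ.* (n ∸ 3) ⟧ - ⟦ ff (d i) 4 ⟧) * i₄
      ≡⟨ cong (λ x → (x - ⟦ ff (d i) 4 ⟧) * i₄) (⟦⟧-* (ff (d i) 3) (n ∸ 3)) ⟩
    (⟦ ff (d i) 3 ⟧ * ⟦ n ∸ 3 ⟧ - ⟦ ff (d i) 4 ⟧) * i₄
      ≡⟨ distribute ⟦ ff (d i) 3 ⟧ ⟦ n ∸ 3 ⟧ ⟦ ff (d i) 4 ⟧ i₄ ⟩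
    ⟦ ff (d i) 3 ⟧ * (⟦ n ∸ 3 ⟧ * i₄) - ⟦ ff (d i) 4 ⟧ * i₄
      ≡⟨ cong (λ x → ⟦ ff (d i) 3 ⟧ * x - ⟦ ff (d i) 4 ⟧ * i₄) (sym i₃≡) ⟩
    ⟦ ff (d i) 3 ⟧ * i₃ - ⟦ ff (d i) 4 ⟧ * i₄ ∎
    where
      open ≡-Reasoning
      distribute : ∀ a b e i → (a * b - e) * i ≡ a * (b * i) - e * i
      distribute = solve-∀ ℚ-ring

  variance-Mᵢ : ∀ i → variance c (λ f → ⟦ Mᵢ G i f ⟧) ≡
    (⟦ ff (d i) 3 ℕ.* (n ∸ d i) ⟧ ÷₀ q 4) * S
    - ((⟦ ff (d i) 2 ⟧ ÷₀ q 2) * (⟦ ff (d i) 2 ⟧ ÷₀ q 2) - ⟦ ff (d i) 4 ⟧ ÷₀ q 4) * (m * m)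
    + (⟦ ff (d i) 2 ⟧ ÷₀ q 2 - ⟦ 2 ⟧ * (⟦ ff (d i) 3 ⟧ ÷₀ q 3) + ⟦ ff (d i) 4 ⟧ ÷₀ q 4) * m
  variance-Mᵢ i = begin
    variance c (λ f → ⟦ Mᵢ G i f ⟧)
      ≡⟨ variance≡ c (λ f → ⟦ Mᵢ G i f ⟧) ⟩
    mean c (λ f → ⟦ Mᵢ G i f ⟧ * ⟦ Mᵢ G i f ⟧) - mean c (λ f → ⟦ Mᵢ G i f ⟧) * mean c (λ f → ⟦ Mᵢ G i f ⟧)
      ≡⟨ cong₂ (λ E₂ E₁ → E₂ - E₁ * E₁) (mean-Mᵢ² i) (mean-Mᵢ-inv i) ⟩
    (x₄ * (m * m - S + m) + x₃ * (S - two * m) + x₂ * m) - (m * x₂) * (m * x₂)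
      ≡⟨ variance-by-overlap m S x₂ x₃ x₄ ⟩
    shape (x₃ - x₄) x₂ x₃ x₄ two
      ≡⟨ shape-cong (trans (sym (⟦ff₃*[n∸cᵢ]⟧ i)) (sym (÷₀≡*inv _ (q 4)))) (sym (÷₀≡*inv _ (q 2))) (sym (÷₀≡*inv _ (q 3)))
                    (sym (÷₀≡*inv _ (q 4))) ⟦2⟧ ⟩
    shape (⟦ ff (d i) 3 ℕ.* (n ∸ d i) ⟧ ÷₀ q 4) (⟦ ff (d i) 2 ⟧ ÷₀ q 2) (⟦ ff (d i) 3 ⟧ ÷₀ q 3) (⟦ ff (d i) 4 ⟧ ÷₀ q 4) ⟦ 2 ⟧ ∎
    where
      open ≡-Reasoning
      x₂ = ⟦ ff (d i) 2 ⟧ * i₂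
      x₃ = ⟦ ff (d i) 3 ⟧ * i₃
      x₄ = ⟦ ff (d i) 4 ⟧ * i₄
      shape : ℚ → ℚ → ℚ → ℚ → ℚ → ℚ
      shape y a b e t = y * S - (a * a - e) * (m * m) + (a - t * b + e) * m
      shape-cong : ∀ {y y′ a a′ b b′ e e′ t t′} → y ≡ y′ → a ≡ a′ → b ≡ b′ → e ≡ e′ → t ≡ t′ → shape y a b e t ≡ shape y′ a′ b′ e′ t′
      shape-cong refl refl refl refl refl = refl

  private
    P₂ P₃ P₂₂ : ℕ
    P₂ = ∑[ i < s ] ff (d i) 2
    P₃ = ∑[ i < s ] ff (d i) 3
    P₂₂ = ∑[ i < s ] ff (d i) 4 ℕ.+ ∑[ i < s ] ∑[ j < s ] ((1 ∸ δ i j) ℕ.* (ff (d i) 2 ℕ.* ff (d j) 2))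

    ∑d≡n : sum d ≡ n
    ∑d≡n = trans (sym (sumFin≡sum d)) (Composition.sums c)

    ⟦n∸⟧≡ν- : ∀ k → k ≤ 4 → ∀ {κ} → κ ≡ ⟦ k ⟧ → ⟦ n ∸ k ⟧ ≡ ν - κ
    ⟦n∸⟧≡ν- k k≤4 κ≡ = trans (⟦⟧-∸ (ℕₚ.≤-trans k≤4 4≤n)) (cong (ν -_) (sym κ≡))

    q₂≡ : q 2 ≡ ν * (ν - 1ℚ)
    q₂≡ = trans (⟦⟧-* (1 ℕ.* n) (n ∸ 1)) (cong₂ _*_ (cong ⟦_⟧ (ℕₚ.*-identityˡ n)) (⟦n∸⟧≡ν- 1 (s≤s z≤n) ⟦1⟧))

    q₄≡ : q 4 ≡ ν * (ν - 1ℚ) * (ν - two) * (ν - three)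
    q₄≡ = trans (⟦⟧-* (ff n 3) (n ∸ 3))
                (cong₂ _*_ (trans (⟦⟧-* (ff n 2) (n ∸ 2)) (cong₂ _*_ q₂≡ (⟦n∸⟧≡ν- 2 (s≤s (s≤s z≤n)) ⟦2⟧)))
                           (⟦n∸⟧≡ν- 3 (s≤s (s≤s (s≤s z≤n))) ⟦3⟧))

    i₂≡′ : i₂ ≡ (ν - two) * (ν - three) * i₄
    i₂≡′ = trans i₂≡ (cong (_* i₄) (trans (⟦⟧-* (n ∸ 2) (n ∸ 3)) (cong₂ _*_ (⟦n∸⟧≡ν- 2 (s≤s (s≤s z≤n)) ⟦2⟧) (⟦n∸⟧≡ν- 3 (s≤s (s≤s (s≤s z≤n))) ⟦3⟧))))

    i₃≡′ : i₃ ≡ (ν - three) * i₄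
    i₃≡′ = trans i₃≡ (cong (_* i₄) (⟦n∸⟧≡ν- 3 (s≤s (s≤s (s≤s z≤n))) ⟦3⟧))

    q₄*i₄ : ν * (ν - 1ℚ) * (ν - two) * (ν - three) * i₄ ≡ 1ℚ
    q₄*i₄ = trans (cong (_* i₄) (sym q₄≡)) (q*inv 4 ℕₚ.≤-refl)

    isolate₃ : ∀ {a b e k} → a + b + e ≡ k → a ≡ k - b - e
    isolate₃ {a} {b} {e} sum≡k = trans (cancel a b e) (cong (λ x → x - b - e) sum≡k)
      where
        cancel : ∀ a b e → a ≡ a + b + e - b - e
        cancel = solve-∀ ℚ-ring

    isolate₄ : ∀ {a b e g k} → a + b + e + g ≡ k → a ≡ k - b - e - g
    isolate₄ {a} {b} {e} {g} sum≡k = trans (cancel a b e g) (cong (λ x → x - b - e - g) sum≡k)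
      where
        cancel : ∀ a b e g → a ≡ a + b + e + g - b - e - g
        cancel = solve-∀ ℚ-ring

    ⟦P₂⟧ : ⟦ P₂ ⟧ ≡ q 2 - two * e₂
    ⟦P₂⟧ = trans (⟦⟧-+-solve P₂ (2 ℕ.* esym 2 (toList d)) (∑ff-2+2esym₂ d ∑d≡n))
                 (cong (q 2 -_) (trans (⟦⟧-* 2 (esym 2 (toList d))) (cong (_* e₂) (sym ⟦2⟧))))

    ⟦P₂⟧′ : ⟦ P₂ ⟧ ≡ ν * (ν - 1ℚ) - two * e₂
    ⟦P₂⟧′ = trans ⟦P₂⟧ (cong (_- two * e₂) q₂≡)

    ⟦P₃⟧ : ⟦ P₃ ⟧ ≡ ν * ν * ν + three * e₃ - three * ⟦ P₂ ⟧ - ν - three * (ν * e₂)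
    ⟦P₃⟧ = isolate₄ (begin
      ⟦ P₃ ⟧ + three * ⟦ P₂ ⟧ + ν + three * (ν * e₂)
        ≡⟨ cong₂ _+_ (cong₂ _+_ (cong (⟦ P₃ ⟧ +_) (trans (cong (_* ⟦ P₂ ⟧) ⟦3⟧) (sym (⟦⟧-* 3 P₂)))) refl)
                     (trans (cong₂ _*_ ⟦3⟧ (sym (⟦⟧-* n (esym 2 (toList d))))) (sym (⟦⟧-* 3 (n ℕ.* esym 2 (toList d))))) ⟩
      ⟦ P₃ ⟧ + ⟦ 3 ℕ.* P₂ ⟧ + ν + ⟦ 3 ℕ.* (n ℕ.* esym 2 (toList d)) ⟧
        ≡⟨ sym (trans (⟦⟧-+ (P₃ ℕ.+ 3 ℕ.* P₂ ℕ.+ n) _) (cong (_+ ⟦ 3 ℕ.* (n ℕ.* esym 2 (toList d)) ⟧)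
                      (trans (⟦⟧-+ (P₃ ℕ.+ 3 ℕ.* P₂) n) (cong (_+ ν) (⟦⟧-+ P₃ (3 ℕ.* P₂)))))) ⟩
      ⟦ P₃ ℕ.+ 3 ℕ.* P₂ ℕ.+ n ℕ.+ 3 ℕ.* (n ℕ.* esym 2 (toList d)) ⟧
        ≡⟨ cong ⟦_⟧ (subst (λ k → P₃ ℕ.+ 3 ℕ.* P₂ ℕ.+ k ℕ.+ 3 ℕ.* (k ℕ.* esym 2 (toList d)) ≡ k ℕ.* k ℕ.* k ℕ.+ 3 ℕ.* esym 3 (toList d))
                           ∑d≡n (∑ff-3 d)) ⟩
      ⟦ n ℕ.* n ℕ.* n ℕ.+ 3 ℕ.* esym 3 (toList d) ⟧
        ≡⟨ trans (⟦⟧-+ (n ℕ.* n ℕ.* n) _) (cong₂ _+_ (trans (⟦⟧-* (n ℕ.* n) n) (cong (_* ν) (⟦⟧-* n n)))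
                                                      (trans (⟦⟧-* 3 (esym 3 (toList d))) (cong (_* e₃) (sym ⟦3⟧)))) ⟩
      ν * ν * ν + three * e₃ ∎)
      where open ≡-Reasoning

    ⟦P₂₂⟧ : ⟦ P₂₂ ⟧ ≡ ⟦ P₂ ⟧ * ⟦ P₂ ⟧ - four * ⟦ P₃ ⟧ - two * ⟦ P₂ ⟧
    ⟦P₂₂⟧ = isolate₃ (begin
      ⟦ P₂₂ ⟧ + four * ⟦ P₃ ⟧ + two * ⟦ P₂ ⟧
        ≡⟨ cong₂ _+_ (cong (⟦ P₂₂ ⟧ +_) (trans (cong (_* ⟦ P₃ ⟧) ⟦4⟧) (sym (⟦⟧-* 4 P₃))))
                     (trans (cong (_* ⟦ P₂ ⟧) ⟦2⟧) (sym (⟦⟧-* 2 P₂))) ⟩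
      ⟦ P₂₂ ⟧ + ⟦ 4 ℕ.* P₃ ⟧ + ⟦ 2 ℕ.* P₂ ⟧
        ≡⟨ sym (trans (⟦⟧-+ (P₂₂ ℕ.+ 4 ℕ.* P₃) (2 ℕ.* P₂)) (cong (_+ ⟦ 2 ℕ.* P₂ ⟧) (⟦⟧-+ P₂₂ (4 ℕ.* P₃)))) ⟩
      ⟦ P₂₂ ℕ.+ 4 ℕ.* P₃ ℕ.+ 2 ℕ.* P₂ ⟧
        ≡⟨ cong ⟦_⟧ (∑ff-2² d) ⟩
      ⟦ P₂ ℕ.* P₂ ⟧
        ≡⟨ ⟦⟧-* P₂ P₂ ⟩
      ⟦ P₂ ⟧ * ⟦ P₂ ⟧ ∎)
      where open ≡-Reasoning

    mean-M-count : mean c (λ f → ⟦ M G f ⟧) ≡ ⟦ numEdges G ℕ.* P₂ ⟧ * i₂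
    mean-M-count = mean-from-count c (M G) (ff n 2) (numEdges G ℕ.* P₂) (ff-n-pos 2 (s≤s (s≤s z≤n))) (∑-M G c)

    mean-M′ : mean c (λ f → ⟦ M G f ⟧) ≡ m * (1ℚ - two * (e₂ * i₂))
    mean-M′ = begin
      mean c (λ f → ⟦ M G f ⟧)          ≡⟨ mean-M-count ⟩
      ⟦ numEdges G ℕ.* P₂ ⟧ * i₂        ≡⟨ cong (_* i₂) (trans (⟦⟧-* (numEdges G) P₂) (cong (m *_) ⟦P₂⟧)) ⟩
      m * (q 2 - two * e₂) * i₂         ≡⟨ distribute m (q 2) e₂ i₂ ⟩
      m * (q 2 * i₂ - two * (e₂ * i₂))  ≡⟨ cong (λ x → m * (x - two * (e₂ * i₂))) (q*inv 2 (s≤s (s≤s z≤n))) ⟩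
      m * (1ℚ - two * (e₂ * i₂))        ∎
      where
        open ≡-Reasoning
        distribute : ∀ m q e i → m * (q - two * e) * i ≡ m * (q * i - two * (e * i))
        distribute = solve-∀ ℚ-ring

    ⟦L⟧≡m-⟦M⟧ : ∀ f → ⟦ L G f ⟧ ≡ m - ⟦ M G f ⟧
    ⟦L⟧≡m-⟦M⟧ f = ⟦⟧-∸ (M≤numEdges G c f)

  mean-M : mean c (λ f → ⟦ M G f ⟧) ≡ (m ÷₀ q 2) * ⟦ sumFin (λ i → ff (d i) 2) ⟧
  mean-M = trans mean-M-count
    (trans (trans (cong (_* i₂) (⟦⟧-* (numEdges G) P₂)) (commute m ⟦ P₂ ⟧ i₂))
           (cong₂ _*_ (sym (÷₀≡*inv m (q 2))) (cong ⟦_⟧ (sym (sumFin≡sum (λ i → ff (d i) 2))))))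
    where
      commute : ∀ x y z → x * y * z ≡ x * z * y
      commute = solve-∀ ℚ-ring

  mean-L : mean c (λ f → ⟦ L G f ⟧) ≡ (⟦ 2 ⟧ * m * e₂) ÷₀ q 2
  mean-L = begin
    mean c (λ f → ⟦ L G f ⟧)            ≡⟨ mean-cong c ⟦L⟧≡m-⟦M⟧ ⟩
    mean c (λ f → m - ⟦ M G f ⟧)        ≡⟨ mean-const-sub c m (λ f → ⟦ M G f ⟧) ⟩
    m - mean c (λ f → ⟦ M G f ⟧)        ≡⟨ cong (m -_) mean-M′ ⟩
    m - m * (1ℚ - two * (e₂ * i₂))      ≡⟨ simplify m e₂ i₂ ⟩
    two * m * e₂ * i₂                   ≡⟨ cong (λ t → t * m * e₂ * i₂) ⟦2⟧ ⟩
    ⟦ 2 ⟧ * m * e₂ * i₂                 ≡⟨ sym (÷₀≡*inv (⟦ 2 ⟧ * m * e₂) (q 2)) ⟩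
    (⟦ 2 ⟧ * m * e₂) ÷₀ q 2             ∎
    where
      open ≡-Reasoning
      simplify : ∀ m e i → m - m * (1ℚ - two * (e * i)) ≡ two * m * e * i
      simplify = solve-∀ ℚ-ring

  private
    mean-M² : mean c (λ f → ⟦ M G f ⟧ * ⟦ M G f ⟧)
              ≡ (⟦ P₂₂ ⟧ * i₄) * (m * m - S + m) + (⟦ P₃ ⟧ * i₃) * (S - two * m) + (⟦ P₂ ⟧ * i₂) * m
    mean-M² = trans (mean-cong c λ f → sym (⟦⟧-* (M G f) (M G f)))
      (trans (mean-from-count c (λ f → M G f ℕ.* M G f) (ff n 4) _ (ff-n-pos 4 ℕₚ.≤-refl) (∑-M² G c))
             (second-moment P₂₂ P₃ P₂))

    σ²-shape : (x₂ y₃ w₄ v₂ ν₁ t₂ t₃ t₄ : ℚ) → ℚ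
    σ²-shape x₂ y₃ w₄ v₂ ν₁ t₂ t₃ t₄ = (a - b) * S + m * m * (b - t₄ * (x₂ * x₂)) + m * (v₂ - t₂ * a + b)
      where
        a = x₂ + y₃
        b = w₄ * (e₂ * e₂ - ν₁ * e₂ - t₃ * e₃)

    σ²-shape-cong : ∀ {x₂ x₂′ y₃ y₃′ w₄ w₄′ v₂ v₂′ ν₁ ν₁′ t₂ t₂′ t₃ t₃′ t₄ t₄′} →
      x₂ ≡ x₂′ → y₃ ≡ y₃′ → w₄ ≡ w₄′ → v₂ ≡ v₂′ → ν₁ ≡ ν₁′ → t₂ ≡ t₂′ → t₃ ≡ t₃′ → t₄ ≡ t₄′ →
      σ²-shape x₂ y₃ w₄ v₂ ν₁ t₂ t₃ t₄ ≡ σ²-shape x₂′ y₃′ w₄′ v₂′ ν₁′ t₂′ t₃′ t₄′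
    σ²-shape-cong refl refl refl refl refl refl refl refl = refl

  σ² : ℚ
  σ² = σ²-shape (e₂ ÷₀ q 2) ((⟦ 3 ⟧ * e₃) ÷₀ q 3) (⟦ 4 ⟧ ÷₀ q 4) ((⟦ 2 ⟧ * e₂) ÷₀ q 2) ⟦ n ∸ 1 ⟧ ⟦ 2 ⟧ ⟦ 3 ⟧ ⟦ 4 ⟧

  variance-M : variance c (λ f → ⟦ M G f ⟧) ≡ σ²
  variance-M = begin
    variance c (λ f → ⟦ M G f ⟧)
      ≡⟨ variance≡ c (λ f → ⟦ M G f ⟧) ⟩
    mean c (λ f → ⟦ M G f ⟧ * ⟦ M G f ⟧) - mean c (λ f → ⟦ M G f ⟧) * mean c (λ f → ⟦ M G f ⟧)
      ≡⟨ cong₂ (λ E₂ E₁ → E₂ - E₁ * E₁) mean-M² mean-M′ ⟩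
    (⟦ P₂₂ ⟧ * i₄) * (m * m - S + m) + (⟦ P₃ ⟧ * i₃) * (S - two * m) + (⟦ P₂ ⟧ * i₂) * m
      - (m * (1ℚ - two * (e₂ * i₂))) * (m * (1ℚ - two * (e₂ * i₂)))
      ≡⟨ variance-by-symmetric-functions {ν} {m} {S} {e₂} {e₃} {i₂} {i₃} {i₄} {⟦ P₂ ⟧} {⟦ P₃ ⟧} {⟦ P₂₂ ⟧}
                                          i₂≡′ i₃≡′ ⟦P₂⟧′ ⟦P₃⟧ ⟦P₂₂⟧ q₄*i₄ ⟩
    σ²-shape (e₂ * i₂) ((three * e₃) * i₃) (four * i₄) ((two * e₂) * i₂) (ν - 1ℚ) two three four
      ≡⟨ σ²-shape-cong (sym (÷₀≡*inv e₂ (q 2))) (trans (cong (λ t → t * e₃ * i₃) ⟦3⟧) (sym (÷₀≡*inv _ (q 3))))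
                       (trans (cong (_* i₄) ⟦4⟧) (sym (÷₀≡*inv _ (q 4)))) (trans (cong (λ t → t * e₂ * i₂) ⟦2⟧) (sym (÷₀≡*inv _ (q 2))))
                       (sym (⟦n∸⟧≡ν- 1 (s≤s z≤n) ⟦1⟧)) ⟦2⟧ ⟦3⟧ ⟦4⟧ ⟩
    σ² ∎
    where open ≡-Reasoning

  variance-L : variance c (λ f → ⟦ L G f ⟧) ≡ σ²
  variance-L = trans (variance-cong c ⟦L⟧≡m-⟦M⟧) (trans (variance-const-sub c m (λ f → ⟦ M G f ⟧)) variance-M)

theorem3 : ∀ {n s : ℕ} (G : SimpleGraph n) (c : Composition n s) → 4 ≤ n →
  let m   = ⟦ numEdges G ⟧
      S2  = ⟦ Σ₂ G ⟧
      cᵢ  = Composition.part c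
      e₂  = ⟦ esym 2 (toList cᵢ) ⟧
      e₃  = ⟦ esym 3 (toList cᵢ) ⟧
      n↓  = λ (k : ℕ) → ⟦ ff n k ⟧
      c↓  = λ (i : Fin s) (k : ℕ) → ⟦ ff (cᵢ i) k ⟧
      a   = e₂ ÷₀ n↓ 2 + (⟦ 3 ⟧ * e₃) ÷₀ n↓ 3
      b   = (⟦ 4 ⟧ ÷₀ n↓ 4) * (e₂ * e₂ - ⟦ n ∸ 1 ⟧ * e₂ - ⟦ 3 ⟧ * e₃)
      σ²  = (a - b) * S2
            + m * m * (b - ⟦ 4 ⟧ * ((e₂ ÷₀ n↓ 2) * (e₂ ÷₀ n↓ 2)))
            + m * ((⟦ 2 ⟧ * e₂) ÷₀ n↓ 2 - ⟦ 2 ⟧ * a + b)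
  in (∀ (i : Fin s) → mean c (λ f → ⟦ Mᵢ G i f ⟧) ≡ m * (c↓ i 2 ÷₀ n↓ 2))
     × (∀ (i : Fin s) → variance c (λ f → ⟦ Mᵢ G i f ⟧)
          ≡ (⟦ ff (cᵢ i) 3 ℕ.* (n ∸ cᵢ i) ⟧ ÷₀ n↓ 4) * S2
            - ((c↓ i 2 ÷₀ n↓ 2) * (c↓ i 2 ÷₀ n↓ 2) - c↓ i 4 ÷₀ n↓ 4) * (m * m)
            + (c↓ i 2 ÷₀ n↓ 2 - ⟦ 2 ⟧ * (c↓ i 3 ÷₀ n↓ 3) + c↓ i 4 ÷₀ n↓ 4) * m)
     × mean c (λ f → ⟦ L G f ⟧) ≡ (⟦ 2 ⟧ * m * e₂) ÷₀ n↓ 2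
     × mean c (λ f → ⟦ M G f ⟧) ≡ (m ÷₀ n↓ 2) * ⟦ sumFin (λ i → ff (cᵢ i) 2) ⟧
     × variance c (λ f → ⟦ L G f ⟧) ≡ σ²
     × variance c (λ f → ⟦ M G f ⟧) ≡ σ²
theorem3 G c 4≤n =
  mean-Mᵢ G c 4≤n , variance-Mᵢ G c 4≤n , mean-L G c 4≤n , mean-M G c 4≤n , variance-L G c 4≤n , variance-M G c 4≤n
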